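{- Let $F$ be a field of characteristic not $2$, let $f(X)=c_dX^d+\cdots+c_1X\in\mathbb{Z}[X]$ (no constant term), and let $\phi=\langle a_1,\ldots,a_n\rangle$ be a nonsingular quadratic form of dimension $n\ge1$ over $F$. Then in $W(F)$, \[f(\phi)=\perp_{p=0}^{n}\Bigl(\sum_{q=p}^{d}\sum_{t=q}^{d}2^{q-p}\,p!\,S(q,p)\binom{t}{q}(-n)^{t-q}c_t\Bigr)\Bigl(\perp_{1\le i_1<\cdots<i_p\le n}\langle\!\langle a_{i_1},\ldots,a_{i_p}\rangle\!\rangle\Bigr),\] where for $p=0$ the Pfister form term is $\langle1\rangle$, and an empty sum is $0$.
   Context: $W(F)$ is the Witt ring of nonsingular quadratic forms over $F$, with addition $\perp$ and multiplication $\otimes$. For an integer $c$ and $\phi\in W(F)$, $c\phi$ is the $|c|$-fold orthogonal sum of $\phi$ with sign $\operatorname{sign}(c)$, and $\phi^i$ is the $i$-fold tensor power; a polynomial $f=\sum c_iX^i\in\mathbb{Z}[X]$ is evaluated at $\phi$ as $f(\phi)=\sum_i c_i\phi^i$. For $a_1,\ldots,a_k\in F^\ast$, $\langle\!\langle a_1,\ldots,a_k\rangle\!\rangle=\langle1,a_1\rangle\otimes\cdots\otimes\langle1,a_k\rangle$. $S(q,p)$ is the Stirling number of the second kind, defined by $x^q=\sum_{p\ge0}S(q,p)x(x-1)\cdots(x-p+1)$; $S(0,0)=1$, $S(q,0)=0$ for $q>0$. -}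

module Defs where

open import Level using (_⊔_)
open import Algebra.Bundles using (CommutativeRing)
open import Data.Nat as ℕ using (ℕ; zero; suc; _∸_; _!)
open import Data.Nat.Combinatorics using (_C_)
open import Data.Integer as ℤ using (ℤ; +_; -[1+_])
open import Data.List using (List; []; _∷_; _++_; map; concatMap; concat; replicate; length; upTo; foldr)
open import Data.Fin using (Fin; zero; suc)
open import Data.Product using (Σ; ∃; _×_)
open import Relation.Nullary using (¬_)
open import Data.List.Relation.Unary.All using (All)

Stirling2 : ℕ → ℕ → ℕ
Stirling2 zero    zero    = 1
Stirling2 zero    (suc p) = 0
Stirling2 (suc q) zero    = 0
Stirling2 (suc q) (suc p) = suc p ℕ.* Stirling2 q (suc p) ℕ.+ Stirling2 q p

-- Σ_{k=a}^{b} g k  (empty, i.e. 0, when a > b)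
sumFromTo : ℕ → ℕ → (ℕ → ℤ) → ℤ
sumFromTo a b g = foldr ℤ._+_ (+ 0) (map (λ i → g (a ℕ.+ i)) (upTo (suc b ∸ a)))

-- Coefficient c_t of f, where the list is [c_1, …, c_d]; c_0 = 0
-- (f has no constant term) and c_t = 0 for t > d.
coeff : List ℤ → ℕ → ℤ
coeff cs zero = + 0
coeff [] (suc t) = + 0
coeff (c ∷ cs) (suc zero) = c
coeff (c ∷ cs) (suc (suc t)) = coeff cs (suc t)

bigCoeff : (n : ℕ) → List ℤ → ℕ → ℤ
bigCoeff n cs p =
  sumFromTo p d (λ q → sumFromTo q d (λ t →
    (+ (2 ℕ.^ (q ∸ p) ℕ.* (p !) ℕ.* Stirling2 q p ℕ.* (t C q)))
    ℤ.* ((ℤ.- (+ n)) ℤ.^ (t ∸ q)) ℤ.* coeff cs t))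
  where d = length cs

-- All sublists of length p (order preserving), i.e. the choices
-- i_1 < … < i_p of positions.
choose : ∀ {a} {A : Set a} → List A → ℕ → List (List A)
choose xs zero = [] ∷ []
choose [] (suc p) = []
choose (x ∷ xs) (suc p) = map (x ∷_) (choose xs p) ++ choose xs (suc p)

-- Quadratic forms and the Witt ring over a commutative ring F
-- (diagonal forms ⟨a_1,…,a_n⟩ represented by the list of the a_i).

module Witt {c ℓ} (F : CommutativeRing c ℓ) where
  open CommutativeRing F using (_≈_; _+_; _*_; -_; 0#; 1#) renaming (Carrier to K)

  record IsField : Set (c ⊔ ℓ) where
    field
      1≉0 : ¬ (1# ≈ 0#)
      inverse : ∀ x → ¬ (x ≈ 0#) → ∃ λ y → x * y ≈ 1#

  Nonsingular : List K → Set (c ⊔ ℓ)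
  Nonsingular = All (λ a → ¬ (a ≈ 0#))

  CharNot2 : Set ℓ
  CharNot2 = ¬ (1# + 1# ≈ 0#)

  Form : Set c
  Form = List K

  _⊥_ : Form → Form → Form
  _⊥_ = _++_

  _⊗_ : Form → Form → Form
  φ ⊗ ψ = concatMap (λ a → map (a *_) ψ) φ

  ⟨1⟩ : Form
  ⟨1⟩ = 1# ∷ []

  neg : Form → Form
  neg = map (-_)

  _·_ : ℤ → Form → Form
  (+ m) · φ = concat (replicate m φ)
  -[1+ m ] · φ = concat (replicate (suc m) (neg φ))

  _^_ : Form → ℕ → Form
  φ ^ zero = ⟨1⟩
  φ ^ suc i = φ ⊗ (φ ^ i)

  ⊥-sum : List Form → Form
  ⊥-sum = foldr _⊥_ []

  evalPoly : List ℤ → Form → Form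
  evalPoly cs φ = ⊥-sum (map (λ i → coeff cs (suc i) · (φ ^ suc i)) (upTo (length cs)))

  -- Pfister form ⟨⟨b_1,…,b_k⟩⟩ = ⟨1,b_1⟩ ⊗ … ⊗ ⟨1,b_k⟩ (⟨1⟩ for k = 0)
  pfister : List K → Form
  pfister = foldr (λ b ψ → (1# ∷ b ∷ []) ⊗ ψ) ⟨1⟩

  ΣF : (n : ℕ) → (Fin n → K) → K
  ΣF zero g = 0#
  ΣF (suc n) g = g zero + ΣF n (λ i → g (suc i))

  lookupF : (φ : Form) → Fin (length φ) → K
  lookupF (a ∷ φ) zero = a
  lookupF (a ∷ φ) (suc i) = lookupF φ i

  δ : ∀ {n} → Fin n → Fin n → K
  δ zero zero = 1#
  δ zero (suc j) = 0#
  δ (suc i) zero = 0#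
  δ (suc i) (suc j) = δ i j

  -- Isometry φ ≅ ψ of diagonal forms: an invertible matrix P
  -- (P : F^{dim ψ} → F^{dim φ}) with Pᵀ diag(φ) P = diag(ψ).
  Isometric : Form → Form → Set (c ⊔ ℓ)
  Isometric φ ψ =
    Σ (Fin (length φ) → Fin (length ψ) → K) λ P →
    Σ (Fin (length ψ) → Fin (length φ) → K) λ Q →
      (∀ i i′ → ΣF (length ψ) (λ j → P i j * Q j i′) ≈ δ i i′) ×
      (∀ j j′ → ΣF (length φ) (λ i → Q j i * P i j′) ≈ δ j j′) ×
      (∀ j k → ΣF (length φ) (λ i → P i j * (lookupF φ i * P i k))
               ≈ lookupF ψ j * δ j k)

  ℍ : Form
  ℍ = 1# ∷ (- 1#) ∷ []

  mℍ : ℕ → Form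
  mℍ m = concat (replicate m ℍ)

  _≈W_ : Form → Form → Set (c ⊔ ℓ)
  φ ≈W ψ = ∃ λ m → ∃ λ k → Isometric (φ ⊥ mℍ m) (ψ ⊥ mℍ k)

{-# OPTIONS --safe #-}

-- Write φ = g₁ + … + gₙ in W(F) with gᵢ = ⟨aᵢ⟩, so that gᵢ² = ⟨aᵢ²⟩ = 1, and put xᵢ = 1 + gᵢ = ⟨⟨aᵢ⟩⟩.
-- Then xᵢ² = 2xᵢ, and the elementary symmetric functions e_p of the xᵢ are the sums of the p-fold
-- Pfister forms ⟨⟨aᵢ₁, …, aᵢₚ⟩⟩. For Y = x₁ + … + xₙ = φ + n one gets Y·e_p = (p+1)·e_{p+1} + 2p·e_p:
-- multiplying a product of p of the xᵢ by one more xᵢ either adds a new factor, and each (p+1)-fold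
-- product arises p+1 times, or squares an old one. This is the recurrence of 2^{q−p} p! S(q,p), so
-- Y^q = Σ_p 2^{q−p} p! S(q,p) e_p. Expanding φ^t = (Y − n)^t = Σ_q C(t,q) (−n)^{t−q} Y^q in f(φ) and
-- collecting the coefficient of e_p gives the formula. Only the ring structure of W(F) enters, so the
-- identity holds for any elements gᵢ with gᵢ² = 1 of a commutative ring; char F ≠ 2 is needed for
-- W(F) itself, to make ⟨a, −a⟩ hyperbolic.

module Submission where

open import Defs
open import Algebra.Bundles using (CommutativeRing)
open import Data.Nat using (ℕ; suc; _≥_)
open import Data.Integer using (ℤ)
open import Data.List using (List; length; map; upTo)

open import Level using (_⊔_)
open import Relation.Binary.Bundles using (Setoid)
open import Data.Nat as ℕ using (zero; _≤_; _<_; _∸_; z≤n; s≤s; _!)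
import Data.Nat.Properties as ℕ
open import Data.Nat.Combinatorics using (_C_)
open import Data.Nat.Combinatorics.Specification using (k>n⇒nCk≡0)
open import Data.Integer as ℤ using (+_; -[1+_]; _⊖_)
import Data.Integer.Properties as ℤ
open import Data.Sign as Sign using (Sign)
open import Data.Fin using (Fin; zero; suc; toℕ; cast)
open import Data.Fin.Properties using (_≟_; toℕ<n; cast-is-id)
open import Data.Fin.Permutation as Perm using (Permutation; _⟨$⟩ʳ_; _⟨$⟩ˡ_)
open import Data.List using ([]; _∷_; _++_; foldr; applyUpTo; lookup; concat; replicate)
import Data.List.Properties as List
open import Data.List.Relation.Binary.Pointwise as Pointwise using (Pointwise; []; _∷_)
import Data.List.Relation.Binary.Permutation.Homogeneous as Homogeneous
open import Data.List.Relation.Unary.All as All using (All; []; _∷_)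
import Data.List.Relation.Unary.All.Properties as All
open import Data.Maybe using (Maybe; just; nothing)
open import Data.Product using (Σ; ∃; ∃₂; _,_; proj₁; proj₂)
open import Data.Empty using (⊥-elim)
open import Function using (_∘_)
open import Relation.Nullary using (yes; no)
open import Relation.Binary.PropositionalEquality as ≡ using (_≡_; _≢_)
import Algebra.Solver.Ring
open import Algebra.Solver.Ring.AlmostCommutativeRing using (fromCommutativeRing; _-Raw-AlmostCommutative⟶_)

module IntegerCoefficients {r ℓ} (R : CommutativeRing r ℓ) where

  open CommutativeRing R
  open import Algebra.Properties.Ring ring
  open import Algebra.Properties.Semiring.Mult semiring using (_×_)
  open import Algebra.Properties.Semiring.Mult.TCOptimised semiring using (1+×; ×-homo-+; ×1-homo-*)
    renaming (_×_ to _×′_)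
  open import Algebra.Properties.CommutativeSemigroup +-commutativeSemigroup using (interchange)
  open import Algebra.Properties.Semiring.Exp semiring using (_^_)
  open import Relation.Binary.Reasoning.Setoid setoid

  -- The tail-optimised multiple (1 × x = x), so that the solver constant con (+ 1) denotes 1# itself.
  fromℕ : ℕ → Carrier
  fromℕ m = m ×′ 1#

  fromℕ-suc : ∀ m → fromℕ (suc m) ≈ 1# + fromℕ m
  fromℕ-suc m = 1+× m 1#

  fromℕ-+ : ∀ m n → fromℕ (m ℕ.+ n) ≈ fromℕ m + fromℕ n
  fromℕ-+ = ×-homo-+ 1#

  fromℕ-* : ∀ m n → fromℕ (m ℕ.* n) ≈ fromℕ m * fromℕ n
  fromℕ-* = ×1-homo-*

  fromℕ-vanishes : ∀ {m} x → m ≡ 0 → fromℕ m * x ≈ 0#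
  fromℕ-vanishes x ≡.refl = zeroˡ x

  fromℤ : ℤ → Carrier
  fromℤ (+ m) = fromℕ m
  fromℤ -[1+ m ] = - fromℕ (suc m)

  fromℤ-⊖ : ∀ m n → fromℤ (m ⊖ n) ≈ fromℕ m - fromℕ n
  fromℤ-⊖ zero zero = sym (trans (+-identityˡ _) -0#≈0#)
  fromℤ-⊖ zero (suc n) = sym (+-identityˡ _)
  fromℤ-⊖ (suc m) zero = sym (trans (+-congˡ -0#≈0#) (+-identityʳ _))
  fromℤ-⊖ (suc m) (suc n) = begin
    fromℤ (suc m ⊖ suc n)           ≡⟨ ≡.cong fromℤ (ℤ.[1+m]⊖[1+n]≡m⊖n m n) ⟩
    fromℤ (m ⊖ n)                   ≈⟨ fromℤ-⊖ m n ⟩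
    fromℕ m - fromℕ n               ≈⟨ +-identityˡ _ ⟨
    0# + (fromℕ m - fromℕ n)        ≈⟨ +-congʳ (-‿inverseʳ 1#) ⟨
    (1# - 1#) + (fromℕ m - fromℕ n) ≈⟨ interchange _ _ _ _ ⟩
    (1# + fromℕ m) + (- 1# + - fromℕ n) ≈⟨ +-congˡ (-‿+-comm 1# (fromℕ n)) ⟩
    (1# + fromℕ m) - (1# + fromℕ n) ≈⟨ +-cong (fromℕ-suc m) (-‿cong (fromℕ-suc n)) ⟨
    fromℕ (suc m) - fromℕ (suc n)   ∎

  fromℤ-+ : ∀ i j → fromℤ (i ℤ.+ j) ≈ fromℤ i + fromℤ j
  fromℤ-+ -[1+ m ] -[1+ n ] = begin
    - fromℕ (suc (suc (m ℕ.+ n)))       ≡⟨ ≡.cong (λ k → - fromℕ (suc k)) (ℕ.+-suc m n) ⟨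
    - fromℕ (suc m ℕ.+ suc n)           ≈⟨ -‿cong (fromℕ-+ (suc m) (suc n)) ⟩
    - (fromℕ (suc m) + fromℕ (suc n))   ≈⟨ -‿+-comm _ _ ⟨
    - fromℕ (suc m) + - fromℕ (suc n)   ∎
  fromℤ-+ -[1+ m ] (+ n) = trans (fromℤ-⊖ n (suc m)) (+-comm _ _)
  fromℤ-+ (+ m) -[1+ n ] = fromℤ-⊖ m (suc n)
  fromℤ-+ (+ m) (+ n) = fromℕ-+ m n

  fromℤ-neg : ∀ i → fromℤ (ℤ.- i) ≈ - fromℤ i
  fromℤ-neg -[1+ n ] = sym (-‿involutive _)
  fromℤ-neg (+ zero) = sym -0#≈0#
  fromℤ-neg (+ suc n) = refl

  private
    signed : Sign → Carrier → Carrier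
    signed Sign.+ x = x
    signed Sign.- x = - x

    fromℤ-◃ : ∀ s n → fromℤ (s ℤ.◃ n) ≈ signed s (fromℕ n)
    fromℤ-◃ Sign.- zero = sym -0#≈0#
    fromℤ-◃ Sign.+ zero = refl
    fromℤ-◃ Sign.- (suc n) = refl
    fromℤ-◃ Sign.+ (suc n) = refl

    fromℤ-signAbs : ∀ i → fromℤ i ≈ signed (ℤ.sign i) (fromℕ ℤ.∣ i ∣)
    fromℤ-signAbs (+ n) = refl
    fromℤ-signAbs -[1+ n ] = refl

    signed-cong : ∀ s {x y} → x ≈ y → signed s x ≈ signed s y
    signed-cong Sign.- = -‿cong
    signed-cong Sign.+ x≈y = x≈y

    signed-* : ∀ s t x y → signed (s Sign.* t) (x * y) ≈ signed s x * signed t y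
    signed-* Sign.- Sign.- x y = begin
      x * y         ≈⟨ -‿involutive _ ⟨
      - - (x * y)   ≈⟨ -‿cong (-‿distribʳ-* x y) ⟩
      - (x * - y)   ≈⟨ -‿distribˡ-* x (- y) ⟩
      - x * - y     ∎
    signed-* Sign.- Sign.+ x y = -‿distribˡ-* x y
    signed-* Sign.+ Sign.- x y = -‿distribʳ-* x y
    signed-* Sign.+ Sign.+ x y = refl

  fromℤ-* : ∀ i j → fromℤ (i ℤ.* j) ≈ fromℤ i * fromℤ j
  fromℤ-* i j = begin
    fromℤ (s ℤ.◃ ∣i∣ ℕ.* ∣j∣)          ≈⟨ fromℤ-◃ s (∣i∣ ℕ.* ∣j∣) ⟩
    signed s (fromℕ (∣i∣ ℕ.* ∣j∣))    ≈⟨ signed-cong s (fromℕ-* ∣i∣ ∣j∣) ⟩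
    signed s (fromℕ ∣i∣ * fromℕ ∣j∣)  ≈⟨ signed-* (ℤ.sign i) (ℤ.sign j) _ _ ⟩
    signed (ℤ.sign i) (fromℕ ∣i∣) * signed (ℤ.sign j) (fromℕ ∣j∣)
      ≈⟨ *-cong (fromℤ-signAbs i) (fromℤ-signAbs j) ⟨
    fromℤ i * fromℤ j                 ∎
    where
    s : Sign
    s = ℤ.sign i Sign.* ℤ.sign j
    ∣i∣ ∣j∣ : ℕ
    ∣i∣ = ℤ.∣ i ∣
    ∣j∣ = ℤ.∣ j ∣

  fromℤ-^ : ∀ i k → fromℤ (i ℤ.^ k) ≈ fromℤ i ^ k
  fromℤ-^ i zero = refl
  fromℤ-^ i (suc k) = trans (fromℤ-* i (i ℤ.^ k)) (*-congˡ (fromℤ-^ i k))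

  infixr 8 _×ℤ_
  _×ℤ_ : ℤ → Carrier → Carrier
  (+ m) ×ℤ x = m × x
  -[1+ m ] ×ℤ x = suc m × (- x)

  ×≈fromℕ* : ∀ m x → m × x ≈ fromℕ m * x
  ×≈fromℕ* zero x = sym (zeroˡ x)
  ×≈fromℕ* (suc m) x = begin
    x + m × x               ≈⟨ +-cong (sym (*-identityˡ x)) (×≈fromℕ* m x) ⟩
    1# * x + fromℕ m * x    ≈⟨ distribʳ x 1# (fromℕ m) ⟨
    (1# + fromℕ m) * x      ≈⟨ *-congʳ (fromℕ-suc m) ⟨
    fromℕ (suc m) * x       ∎

  ×ℤ≈fromℤ* : ∀ i x → i ×ℤ x ≈ fromℤ i * x
  ×ℤ≈fromℤ* (+ m) x = ×≈fromℕ* m x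
  ×ℤ≈fromℤ* -[1+ m ] x = begin
    suc m × (- x)                ≈⟨ ×≈fromℕ* (suc m) (- x) ⟩
    fromℕ (suc m) * - x          ≈⟨ -‿distribʳ-* _ x ⟨
    - (fromℕ (suc m) * x)        ≈⟨ -‿distribˡ-* _ x ⟩
    - fromℕ (suc m) * x          ∎

  fromℤ-morphism : CommutativeRing.rawRing ℤ.+-*-commutativeRing
                     -Raw-AlmostCommutative⟶ fromCommutativeRing R
  fromℤ-morphism = record
    { ⟦_⟧ = fromℤ ; +-homo = fromℤ-+ ; *-homo = fromℤ-* ; -‿homo = fromℤ-neg
    ; 0-homo = refl ; 1-homo = refl }

  fromℤ-≟ : ∀ i j → Maybe (fromℤ i ≈ fromℤ j)
  fromℤ-≟ i j with i ℤ.≟ j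
  ... | yes ≡.refl = just refl
  ... | no _ = nothing

  module ℤ-Solver = Algebra.Solver.Ring
    (CommutativeRing.rawRing ℤ.+-*-commutativeRing) (fromCommutativeRing R) fromℤ-morphism fromℤ-≟

module RangeSums {r ℓ} (R : CommutativeRing r ℓ) where

  open CommutativeRing R
  open IntegerCoefficients R
  open import Algebra.Properties.Semiring.Sum semiring
    using (sum; sum-cong-≋; sum-replicate-zero; ∑-distrib-+; ∑-comm; *-distribˡ-sum; *-distribʳ-sum)
  open import Relation.Binary.Reasoning.Setoid setoid

  sumBelow : ℕ → (ℕ → Carrier) → Carrier
  sumBelow k f = sum {k} (f ∘ toℕ)

  syntax sumBelow k (λ i → x) = ∑[ i < k ] x

  sumBelow-cong : ∀ k {f g} → (∀ i → i < k → f i ≈ g i) → sumBelow k f ≈ sumBelow k g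
  sumBelow-cong k f≈g = sum-cong-≋ (λ i → f≈g (toℕ i) (toℕ<n i))

  sumBelow-zero : ∀ k {f} → (∀ i → i < k → f i ≈ 0#) → sumBelow k f ≈ 0#
  sumBelow-zero k f≈0 = trans (sumBelow-cong k f≈0) (sum-replicate-zero k)

  sumBelow-+ : ∀ k f g → ∑[ i < k ] (f i + g i) ≈ sumBelow k f + sumBelow k g
  sumBelow-+ k f g = ∑-distrib-+ {k} (f ∘ toℕ) (g ∘ toℕ)

  sumBelow-comm : ∀ m n (f : ℕ → ℕ → Carrier) →
                  ∑[ i < m ] ∑[ j < n ] f i j ≈ ∑[ j < n ] ∑[ i < m ] f i j
  sumBelow-comm m n f = ∑-comm {m} {n} (λ i j → f (toℕ i) (toℕ j))

  *-distribˡ-sumBelow : ∀ k x f → x * sumBelow k f ≈ ∑[ i < k ] (x * f i)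
  *-distribˡ-sumBelow k x f = *-distribˡ-sum {k} x (f ∘ toℕ)

  *-distribʳ-sumBelow : ∀ k x f → sumBelow k f * x ≈ ∑[ i < k ] (f i * x)
  *-distribʳ-sumBelow k x f = *-distribʳ-sum {k} x (f ∘ toℕ)

  sumBelow-suc : ∀ k f → sumBelow (suc k) f ≈ sumBelow k f + f k
  sumBelow-suc zero f = trans (+-identityʳ _) (sym (+-identityˡ _))
  sumBelow-suc (suc k) f = trans (+-congˡ (sumBelow-suc k (f ∘ suc))) (sym (+-assoc _ _ _))

  sumBelow-split : ∀ a k f → sumBelow (a ℕ.+ k) f ≈ sumBelow a f + ∑[ i < k ] f (a ℕ.+ i)
  sumBelow-split zero k f = sym (+-identityˡ _)
  sumBelow-split (suc a) k f = trans (+-congˡ (sumBelow-split a k (f ∘ suc))) (sym (+-assoc _ _ _))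

  sumBelow-window : ∀ a k B f → a ℕ.+ k ≤ B →
                    (∀ i → i < a → f i ≈ 0#) → (∀ i → a ℕ.+ k ≤ i → f i ≈ 0#) →
                    ∑[ i < k ] f (a ℕ.+ i) ≈ sumBelow B f
  sumBelow-window a k B f a+k≤B below above = begin
    ∑[ i < k ] f (a ℕ.+ i)                      ≈⟨ +-identityˡ _ ⟨
    0# + ∑[ i < k ] f (a ℕ.+ i)                 ≈⟨ +-congʳ (sumBelow-zero a below) ⟨
    sumBelow a f + ∑[ i < k ] f (a ℕ.+ i)       ≈⟨ sumBelow-split a k f ⟨
    sumBelow (a ℕ.+ k) f                        ≈⟨ +-identityʳ _ ⟨
    sumBelow (a ℕ.+ k) f + 0#                   ≈⟨ +-congˡ (sumBelow-zero rest (λ i _ → above _ (ℕ.m≤m+n _ i))) ⟨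
    sumBelow (a ℕ.+ k) f + ∑[ i < rest ] f (a ℕ.+ k ℕ.+ i) ≈⟨ sumBelow-split (a ℕ.+ k) rest f ⟨
    sumBelow (a ℕ.+ k ℕ.+ rest) f               ≡⟨ ≡.cong (λ m → sumBelow m f) (ℕ.m+[n∸m]≡n a+k≤B) ⟩
    sumBelow B f                                ∎
    where
    rest : ℕ
    rest = B ∸ (a ℕ.+ k)

  sumBelow-extend : ∀ k B f → k ≤ B → (∀ i → k ≤ i → f i ≈ 0#) → sumBelow k f ≈ sumBelow B f
  sumBelow-extend k B f k≤B above = sumBelow-window 0 k B f k≤B (λ _ ()) above

  sumList : List Carrier → Carrier
  sumList = foldr _+_ 0#

  sumList-++ : ∀ xs ys → sumList (xs ++ ys) ≈ sumList xs + sumList ys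
  sumList-++ [] ys = sym (+-identityˡ _)
  sumList-++ (x ∷ xs) ys = trans (+-congˡ (sumList-++ xs ys)) (sym (+-assoc _ _ _))

  *-distribˡ-sumList : ∀ x xs → x * sumList xs ≈ sumList (map (x *_) xs)
  *-distribˡ-sumList x [] = zeroʳ x
  *-distribˡ-sumList x (y ∷ xs) = trans (distribˡ x y _) (+-congˡ (*-distribˡ-sumList x xs))

  sumList-applyUpTo : ∀ k f → sumList (applyUpTo f k) ≡ sumBelow k f
  sumList-applyUpTo zero f = ≡.refl
  sumList-applyUpTo (suc k) f = ≡.cong (λ s → f 0 + s) (sumList-applyUpTo k (f ∘ suc))

  sumList-upTo : ∀ k f → sumList (map f (upTo k)) ≡ sumBelow k f
  sumList-upTo k f = ≡.trans (≡.cong sumList (List.map-applyUpTo (λ i → i) f k)) (sumList-applyUpTo k f)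

  fromℤ-sumList : ∀ is → fromℤ (foldr ℤ._+_ (+ 0) is) ≈ sumList (map fromℤ is)
  fromℤ-sumList [] = refl
  fromℤ-sumList (i ∷ is) = trans (fromℤ-+ i _) (+-congˡ (fromℤ-sumList is))

  fromℤ-sumFromTo : ∀ a b g → fromℤ (sumFromTo a b g) ≈ ∑[ i < suc b ∸ a ] fromℤ (g (a ℕ.+ i))
  fromℤ-sumFromTo a b g = begin
    fromℤ (sumFromTo a b g)                            ≈⟨ fromℤ-sumList (map g′ (upTo k)) ⟩
    sumList (map fromℤ (map g′ (upTo k)))              ≡⟨ ≡.cong sumList (List.map-∘ (upTo k)) ⟨
    sumList (map (fromℤ ∘ g′) (upTo k))                ≡⟨ sumList-upTo k (fromℤ ∘ g′) ⟩
    ∑[ i < k ] fromℤ (g (a ℕ.+ i))                     ∎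
    where
    k : ℕ
    k = suc b ∸ a
    g′ : ℕ → ℤ
    g′ i = g (a ℕ.+ i)

  fromℤ-sumFromTo-extend : ∀ a b B g → b < B →
    (∀ i → i < a → fromℤ (g i) ≈ 0#) → (∀ i → b < i → fromℤ (g i) ≈ 0#) →
    fromℤ (sumFromTo a b g) ≈ ∑[ i < B ] fromℤ (g i)
  fromℤ-sumFromTo-extend a b B g b<B below above with a ℕ.≤? suc b
  ... | yes a≤1+b = trans (fromℤ-sumFromTo a b g)
          (sumBelow-window a (suc b ∸ a) B (fromℤ ∘ g) (≡.subst (_≤ B) (≡.sym a+k≡1+b) b<B) below
            (λ i a+k≤i → above i (≡.subst (_≤ i) a+k≡1+b a+k≤i)))
    where
    a+k≡1+b : a ℕ.+ (suc b ∸ a) ≡ suc b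
    a+k≡1+b = ℕ.m+[n∸m]≡n a≤1+b
  ... | no a≰1+b = begin
    fromℤ (sumFromTo a b g)                 ≈⟨ fromℤ-sumFromTo a b g ⟩
    ∑[ i < suc b ∸ a ] fromℤ (g (a ℕ.+ i))  ≡⟨ ≡.cong (λ k → ∑[ i < k ] fromℤ (g (a ℕ.+ i))) empty ⟩
    0#                                      ≈⟨ sumBelow-zero B (λ i _ → vanishes i) ⟨
    ∑[ i < B ] fromℤ (g i)                  ∎
    where
    1+b≤a : suc b ≤ a
    1+b≤a = ℕ.<⇒≤ (ℕ.≰⇒> a≰1+b)
    empty : suc b ∸ a ≡ 0
    empty = ℕ.m≤n⇒m∸n≡0 1+b≤a
    vanishes : ∀ i → fromℤ (g i) ≈ 0#
    vanishes i with i ℕ.<? a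
    ... | yes i<a = below i i<a
    ... | no i≮a = above i (ℕ.≤-trans 1+b≤a (ℕ.≮⇒≥ i≮a))

  sumBelow-reorder₃ : ∀ B (x : ℕ → Carrier) (y w : ℕ → ℕ → Carrier) (e : ℕ → Carrier) →
    ∑[ t < B ] (x t * ∑[ q < B ] (y t q * ∑[ p < B ] (w q p * e p)))
      ≈ ∑[ p < B ] (∑[ q < B ] ∑[ t < B ] (w q p * y t q * x t) * e p)
  sumBelow-reorder₃ B x y w e = begin
    ∑[ t < B ] (x t * ∑[ q < B ] (y t q * ∑[ p < B ] (w q p * e p)))
      ≈⟨ sumBelow-cong B (λ t _ → distribute t) ⟩
    ∑[ t < B ] ∑[ q < B ] ∑[ p < B ] T t q p
      ≈⟨ sumBelow-cong B (λ t _ → sumBelow-comm B B (T t)) ⟩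
    ∑[ t < B ] ∑[ p < B ] ∑[ q < B ] T t q p
      ≈⟨ sumBelow-comm B B (λ t p → ∑[ q < B ] T t q p) ⟩
    ∑[ p < B ] ∑[ t < B ] ∑[ q < B ] T t q p
      ≈⟨ sumBelow-cong B (λ p _ → sumBelow-comm B B (λ t q → T t q p)) ⟩
    ∑[ p < B ] ∑[ q < B ] ∑[ t < B ] T t q p
      ≈⟨ sumBelow-cong B (λ p _ → factor p) ⟩
    ∑[ p < B ] (∑[ q < B ] ∑[ t < B ] (w q p * y t q * x t) * e p) ∎
    where
    open ℤ-Solver using (solve; _:*_; _:=_)
    T : ℕ → ℕ → ℕ → Carrier
    T t q p = w q p * y t q * x t * e p
    distribute : ∀ t → x t * ∑[ q < B ] (y t q * ∑[ p < B ] (w q p * e p)) ≈ ∑[ q < B ] ∑[ p < B ] T t q p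
    distribute t = trans (*-distribˡ-sumBelow B (x t) (λ q → y t q * ∑[ p < B ] (w q p * e p)))
                         (sumBelow-cong B (λ q _ → distribute₂ t q))
      where
      distribute₂ : ∀ t q → x t * (y t q * ∑[ p < B ] (w q p * e p)) ≈ ∑[ p < B ] T t q p
      distribute₂ t q = begin
        x t * (y t q * ∑[ p < B ] (w q p * e p))
          ≈⟨ *-congˡ (*-distribˡ-sumBelow B (y t q) (λ p → w q p * e p)) ⟩
        x t * ∑[ p < B ] (y t q * (w q p * e p))
          ≈⟨ *-distribˡ-sumBelow B (x t) (λ p → y t q * (w q p * e p)) ⟩
        ∑[ p < B ] (x t * (y t q * (w q p * e p)))
          ≈⟨ sumBelow-cong B (λ p _ → solve 4 (λ x y w e → x :* (y :* (w :* e)) := w :* y :* x :* e)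
                                               refl (x t) (y t q) (w q p) (e p)) ⟩
        ∑[ p < B ] T t q p ∎
    factor : ∀ p → ∑[ q < B ] ∑[ t < B ] T t q p ≈ ∑[ q < B ] ∑[ t < B ] (w q p * y t q * x t) * e p
    factor p = sym (trans (*-distribʳ-sumBelow B (e p) (λ q → ∑[ t < B ] (w q p * y t q * x t)))
                          (sumBelow-cong B (λ q _ → *-distribʳ-sumBelow B (e p) (λ t → w q p * y t q * x t))))

module StirlingWeights where

  open import Data.Nat using (_+_; _*_; _^_)
  open import Data.Nat.Solver using (module +-*-Solver)

  Stirling2-vanishes : ∀ q p → q < p → Stirling2 q p ≡ 0
  Stirling2-vanishes zero (suc p) _ = ≡.refl
  Stirling2-vanishes (suc q) (suc p) (s≤s q<p)
    rewrite Stirling2-vanishes q (suc p) (ℕ.m<n⇒m<1+n q<p) | Stirling2-vanishes q p q<p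
    = ≡.trans (ℕ.+-identityʳ (p * 0)) (ℕ.*-zeroʳ p)

  scaledStirling : ℕ → ℕ → ℕ
  scaledStirling q p = 2 ^ (q ∸ p) * p ! * Stirling2 q p

  scaledStirling-vanishes : ∀ q p → q < p → scaledStirling q p ≡ 0
  scaledStirling-vanishes q p q<p rewrite Stirling2-vanishes q p q<p = ℕ.*-zeroʳ (2 ^ (q ∸ p) * p !)

  scaledStirling-suc-zero : ∀ q → scaledStirling (suc q) 0 ≡ 0
  scaledStirling-suc-zero q = ℕ.*-zeroʳ (2 ^ suc q * 1)

  private
    2^-∸-suc : ∀ q p → p < q → 2 ^ (q ∸ p) ≡ 2 * 2 ^ (q ∸ suc p)
    2^-∸-suc (suc q) zero _ = ≡.refl
    2^-∸-suc (suc q) (suc p) (s≤s p<q) = 2^-∸-suc q p p<q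

    -- For q ≤ p the two powers differ (truncated subtraction), but then S(q, p+1) = 0.
    2^-∸-suc-Stirling2 : ∀ q p →
      2 ^ (q ∸ p) * Stirling2 q (suc p) ≡ 2 * 2 ^ (q ∸ suc p) * Stirling2 q (suc p)
    2^-∸-suc-Stirling2 q p with p ℕ.<? q
    ... | yes p<q = ≡.cong (_* Stirling2 q (suc p)) (2^-∸-suc q p p<q)
    ... | no p≮q rewrite Stirling2-vanishes q (suc p) (s≤s (ℕ.≮⇒≥ p≮q)) =
      ≡.trans (ℕ.*-zeroʳ (2 ^ (q ∸ p))) (≡.sym (ℕ.*-zeroʳ (2 * 2 ^ (q ∸ suc p))))

  scaledStirling-suc-suc : ∀ q p →
    scaledStirling (suc q) (suc p) ≡ suc p * scaledStirling q p + (suc p + suc p) * scaledStirling q (suc p)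
  scaledStirling-suc-suc q p = begin
    2^ * (k * p!) * (k * S₁ + S₀)
      ≡⟨ solve 5 (λ 2^ k p! S₁ S₀ → 2^ :* (k :* p!) :* (k :* S₁ :+ S₀)
                                  := k :* (2^ :* p! :* S₀) :+ k :* k :* p! :* (2^ :* S₁)) ≡.refl 2^ k p! S₁ S₀ ⟩
    k * (2^ * p! * S₀) + k * k * p! * (2^ * S₁)
      ≡⟨ ≡.cong (λ x → k * (2^ * p! * S₀) + k * k * p! * x) (2^-∸-suc-Stirling2 q p) ⟩
    k * (2^ * p! * S₀) + k * k * p! * (2 * 2^′ * S₁)
      ≡⟨ ≡.cong (λ x → k * (2^ * p! * S₀) + x)
                (solve 4 (λ 2^′ k p! S₁ → k :* k :* p! :* (con 2 :* 2^′ :* S₁) := (k :+ k) :* (2^′ :* (k :* p!) :* S₁))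
                         ≡.refl 2^′ k p! S₁) ⟩
    k * (2^ * p! * S₀) + (k + k) * (2^′ * (k * p!) * S₁) ∎
    where
    open ≡.≡-Reasoning
    open +-*-Solver
    2^ 2^′ k p! S₁ S₀ : ℕ
    2^ = 2 ^ (q ∸ p)
    2^′ = 2 ^ (q ∸ suc p)
    k = suc p
    p! = p !
    S₁ = Stirling2 q (suc p)
    S₀ = Stirling2 q p

open StirlingWeights

choose-length< : ∀ {a} {A : Set a} (xs : List A) p → length xs < p → choose xs p ≡ []
choose-length< [] (suc p) _ = ≡.refl
choose-length< (x ∷ xs) (suc p) (s≤s |xs|<p)
  rewrite choose-length< xs p |xs|<p | choose-length< xs (suc p) (ℕ.m<n⇒m<1+n |xs|<p) = ≡.refl

coeff-length< : ∀ cs t → length cs < t → coeff cs t ≡ + 0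
coeff-length< [] (suc t) _ = ≡.refl
coeff-length< (c ∷ cs) (suc (suc t)) (s≤s |cs|<1+t) = coeff-length< cs (suc t) |cs|<1+t

choose-map : ∀ {a b} {A : Set a} {B : Set b} (f : A → B) xs p →
             choose (map f xs) p ≡ map (map f) (choose xs p)
choose-map f xs zero = ≡.refl
choose-map f [] (suc p) = ≡.refl
choose-map {A = A} f (x ∷ xs) (suc p) = begin
  map (f x ∷_) (choose (map f xs) p) ++ choose (map f xs) (suc p)
    ≡⟨ ≡.cong₂ (λ L L′ → map (f x ∷_) L ++ L′) (choose-map f xs p) (choose-map f xs (suc p)) ⟩
  map (f x ∷_) (map (map f) S) ++ map (map f) S′
    ≡⟨ ≡.cong (_++ map (map f) S′) (≡.trans (≡.sym (List.map-∘ S)) (List.map-∘ S)) ⟩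
  map (map f) (map (x ∷_) S) ++ map (map f) S′
    ≡⟨ List.map-++ (map f) (map (x ∷_) S) S′ ⟨
  map (map f) (map (x ∷_) S ++ S′) ∎
  where
  open ≡.≡-Reasoning
  S S′ : List (List A)
  S = choose xs p
  S′ = choose xs (suc p)

map-proj₁-toList : ∀ {a p} {A : Set a} {P : A → Set p} {xs} (pxs : All P xs) →
                   map proj₁ (All.toList pxs) ≡ xs
map-proj₁-toList [] = ≡.refl
map-proj₁-toList (px ∷ pxs) = ≡.cong (_ ∷_) (map-proj₁-toList pxs)

module PfisterCalculus {r ℓ} (R : CommutativeRing r ℓ) where

  open CommutativeRing R hiding (zero)
  open IntegerCoefficients R
  open RangeSums R
  open ℤ-Solver using (Polynomial; solve; _:+_; _:*_; _:=_; con)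
  open import Algebra.Properties.Semiring.Exp semiring using (_^_)
  open import Algebra.Properties.CommutativeSemigroup +-commutativeSemigroup using (interchange)
  open import Algebra.Properties.CommutativeSemigroup *-commutativeSemigroup using (x∙yz≈y∙xz)
  open import Relation.Binary.Reasoning.Setoid setoid

  private
    :0 :1 : ∀ {n} → Polynomial n
    :0 = con (+ 0)
    :1 = con (+ 1)

  SquaresToOne : Carrier → Set ℓ
  SquaresToOne g = g * g ≈ 1#

  pfisterProduct : List Carrier → Carrier
  pfisterProduct = foldr (λ g x → (1# + g) * x) 1#

  pfisterSum : List Carrier → ℕ → Carrier
  pfisterSum gs p = sumList (map pfisterProduct (choose gs p))

  shiftedSum : List Carrier → Carrier
  shiftedSum gs = sumList (map (λ g → 1# + g) gs)

  pfisterSum-cons : ∀ g gs p →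
    pfisterSum (g ∷ gs) (suc p) ≈ (1# + g) * pfisterSum gs p + pfisterSum gs (suc p)
  pfisterSum-cons g gs p = begin
    sumList (map Π (map (g ∷_) L ++ L′))
      ≡⟨ ≡.cong sumList (List.map-++ Π (map (g ∷_) L) L′) ⟩
    sumList (map Π (map (g ∷_) L) ++ map Π L′)
      ≈⟨ sumList-++ (map Π (map (g ∷_) L)) (map Π L′) ⟩
    sumList (map Π (map (g ∷_) L)) + e′
      ≡⟨ ≡.cong (λ xs → sumList xs + e′) (≡.trans (≡.sym (List.map-∘ L)) (List.map-∘ L)) ⟩
    sumList (map ((1# + g) *_) (map Π L)) + e′
      ≈⟨ +-congʳ (*-distribˡ-sumList (1# + g) (map Π L)) ⟨
    (1# + g) * pfisterSum gs p + e′ ∎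
    where
    Π : List Carrier → Carrier
    Π = pfisterProduct
    L L′ : List (List Carrier)
    L = choose gs p
    L′ = choose gs (suc p)
    e′ : Carrier
    e′ = pfisterSum gs (suc p)

  pfisterSum-vanishes : ∀ gs p → length gs < p → pfisterSum gs p ≈ 0#
  pfisterSum-vanishes gs p |gs|<p = reflexive (≡.cong (sumList ∘ map pfisterProduct) (choose-length< gs p |gs|<p))

  *-pfisterSum-vanishes : ∀ x gs p → length gs < p → x * pfisterSum gs p ≈ 0#
  *-pfisterSum-vanishes x gs p |gs|<p = trans (*-congˡ (pfisterSum-vanishes gs p |gs|<p)) (zeroʳ x)

  shiftedSum≈length+sum : ∀ gs → shiftedSum gs ≈ fromℕ (length gs) + sumList gs
  shiftedSum≈length+sum [] = sym (+-identityˡ 0#)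
  shiftedSum≈length+sum (g ∷ gs) = begin
    (1# + g) + shiftedSum gs                    ≈⟨ +-congˡ (shiftedSum≈length+sum gs) ⟩
    (1# + g) + (fromℕ (length gs) + sumList gs) ≈⟨ interchange _ _ _ _ ⟩
    (1# + fromℕ (length gs)) + (g + sumList gs) ≈⟨ +-congʳ (fromℕ-suc (length gs)) ⟨
    fromℕ (suc (length gs)) + (g + sumList gs)  ∎

  1+-square : ∀ {g} → SquaresToOne g → (1# + g) * (1# + g) ≈ (1# + g) + (1# + g)
  1+-square {g} g²≈1 = begin
    (1# + g) * (1# + g)  ≈⟨ solve 1 (λ g → (:1 :+ g) :* (:1 :+ g) := (:1 :+ g :+ g) :+ g :* g) refl g ⟩
    (1# + g + g) + g * g ≈⟨ +-congˡ g²≈1 ⟩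
    (1# + g + g) + 1#    ≈⟨ solve 1 (λ g → (:1 :+ g :+ g) :+ :1 := (:1 :+ g) :+ (:1 :+ g)) refl g ⟩
    (1# + g) + (1# + g)  ∎

  shiftedSum-*-pfisterSum : ∀ gs → All SquaresToOne gs → ∀ p →
    shiftedSum gs * pfisterSum gs p
      ≈ fromℕ (suc p) * pfisterSum gs (suc p) + (fromℕ p + fromℕ p) * pfisterSum gs p
  shiftedSum-*-pfisterSum [] [] zero =
    solve 0 (:0 :* (:1 :+ :0) := :1 :* :0 :+ (:0 :+ :0) :* (:1 :+ :0)) refl
  shiftedSum-*-pfisterSum [] [] (suc p) =
    solve 2 (λ m n → :0 :* :0 := m :* :0 :+ (n :+ n) :* :0) refl (fromℕ (suc (suc p))) (fromℕ (suc p))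
  shiftedSum-*-pfisterSum (g ∷ gs) (_ ∷ gs²) zero = begin
    (x + Y) * (1# + 0#)
      ≈⟨ distribʳ _ x Y ⟩
    x * (1# + 0#) + Y * (1# + 0#)
      ≈⟨ +-congˡ (shiftedSum-*-pfisterSum gs gs² 0) ⟩
    x * (1# + 0#) + (1# * e₁ + (0# + 0#) * (1# + 0#))
      ≈⟨ solve 2 (λ x e₁ → x :* (:1 :+ :0) :+ (:1 :* e₁ :+ (:0 :+ :0) :* (:1 :+ :0))
                          := :1 :* (x :* (:1 :+ :0) :+ e₁) :+ (:0 :+ :0) :* (:1 :+ :0)) refl x e₁ ⟩
    1# * (x * (1# + 0#) + e₁) + (0# + 0#) * (1# + 0#)
      ≈⟨ +-congʳ (*-congˡ (pfisterSum-cons g gs 0)) ⟨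
    1# * pfisterSum (g ∷ gs) 1 + (0# + 0#) * (1# + 0#) ∎
    where
    x Y e₁ : Carrier
    x = 1# + g
    Y = shiftedSum gs
    e₁ = pfisterSum gs 1
  shiftedSum-*-pfisterSum (g ∷ gs) (g²≈1 ∷ gs²) (suc q) = begin
    (x + Y) * pfisterSum (g ∷ gs) (suc q)
      ≈⟨ *-congˡ (pfisterSum-cons g gs q) ⟩
    (x + Y) * (x * e₀ + e₁)
      ≈⟨ solve 4 (λ x Y e₀ e₁ → (x :+ Y) :* (x :* e₀ :+ e₁)
                              := x :* x :* e₀ :+ x :* e₁ :+ x :* (Y :* e₀) :+ Y :* e₁) refl x Y e₀ e₁ ⟩
    x * x * e₀ + x * e₁ + x * (Y * e₀) + Y * e₁
      ≈⟨ +-cong (+-cong (+-congʳ (*-congʳ (1+-square g²≈1))) (*-congˡ (shiftedSum-*-pfisterSum gs gs² q)))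
                (shiftedSum-*-pfisterSum gs gs² (suc q)) ⟩
    (x + x) * e₀ + x * e₁ + x * (fromℕ (suc q) * e₁ + (n + n) * e₀)
      + (fromℕ (suc (suc q)) * e₂ + (fromℕ (suc q) + fromℕ (suc q)) * e₁)
      ≈⟨ +-cong (+-congˡ (*-congˡ (+-congʳ (*-congʳ n₁≈))))
                (+-cong (*-congʳ n₂≈) (*-congʳ (+-cong n₁≈ n₁≈))) ⟩
    (x + x) * e₀ + x * e₁ + x * ((1# + n) * e₁ + (n + n) * e₀)
      + ((1# + (1# + n)) * e₂ + ((1# + n) + (1# + n)) * e₁)
      ≈⟨ solve 5 (λ x n e₀ e₁ e₂ →
             (x :+ x) :* e₀ :+ x :* e₁ :+ x :* ((:1 :+ n) :* e₁ :+ (n :+ n) :* e₀)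
               :+ ((:1 :+ (:1 :+ n)) :* e₂ :+ ((:1 :+ n) :+ (:1 :+ n)) :* e₁)
           := (:1 :+ (:1 :+ n)) :* (x :* e₁ :+ e₂) :+ ((:1 :+ n) :+ (:1 :+ n)) :* (x :* e₀ :+ e₁))
           refl x n e₀ e₁ e₂ ⟩
    (1# + (1# + n)) * (x * e₁ + e₂) + ((1# + n) + (1# + n)) * (x * e₀ + e₁)
      ≈⟨ +-cong (*-cong n₂≈ (pfisterSum-cons g gs (suc q)))
                (*-cong (+-cong n₁≈ n₁≈) (pfisterSum-cons g gs q)) ⟨
    fromℕ (suc (suc q)) * pfisterSum (g ∷ gs) (suc (suc q))
      + (fromℕ (suc q) + fromℕ (suc q)) * pfisterSum (g ∷ gs) (suc q) ∎
    where
    x Y n e₀ e₁ e₂ : Carrier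
    x = 1# + g
    Y = shiftedSum gs
    n = fromℕ q
    e₀ = pfisterSum gs q
    e₁ = pfisterSum gs (suc q)
    e₂ = pfisterSum gs (suc (suc q))
    n₁≈ : fromℕ (suc q) ≈ 1# + n
    n₁≈ = fromℕ-suc q
    n₂≈ : fromℕ (suc (suc q)) ≈ 1# + (1# + n)
    n₂≈ = trans (fromℕ-suc (suc q)) (+-congˡ n₁≈)

  shiftedSum-^ : ∀ gs → All SquaresToOne gs → ∀ q →
    shiftedSum gs ^ q ≈ ∑[ p < suc (length gs) ] (fromℕ (scaledStirling q p) * pfisterSum gs p)
  shiftedSum-^ gs gs² zero = sym (begin
    1# * (1# + 0#) + ∑[ p < N ] (fromℕ (scaledStirling 0 (suc p)) * e (suc p))
      ≈⟨ +-congˡ (sumBelow-zero N (λ p _ →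
           fromℕ-vanishes (e (suc p)) (scaledStirling-vanishes 0 (suc p) (s≤s z≤n)))) ⟩
    1# * (1# + 0#) + 0#  ≈⟨ solve 0 (:1 :* (:1 :+ :0) :+ :0 := :1) refl ⟩
    1#                   ∎)
    where
    N : ℕ
    N = length gs
    e : ℕ → Carrier
    e = pfisterSum gs
  shiftedSum-^ gs gs² (suc q) = begin
    Y * Y ^ q
      ≈⟨ *-congˡ (shiftedSum-^ gs gs² q) ⟩
    Y * ∑[ p < suc N ] (a q p * e p)
      ≈⟨ *-distribˡ-sumBelow (suc N) Y (λ p → a q p * e p) ⟩
    ∑[ p < suc N ] (Y * (a q p * e p))
      ≈⟨ sumBelow-cong (suc N) (λ p _ → raise p) ⟩
    ∑[ p < suc N ] (A p + B p)
      ≈⟨ sumBelow-+ (suc N) A B ⟩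
    sumBelow (suc N) A + sumBelow (suc N) B
      ≈⟨ +-cong (sumBelow-suc N A) (+-congʳ B₀≈0) ⟩
    (sumBelow N A + A N) + (0# + ∑[ p < N ] B (suc p))
      ≈⟨ +-cong (trans (+-congˡ A-top≈0) (+-identityʳ _)) (+-identityˡ _) ⟩
    sumBelow N A + ∑[ p < N ] B (suc p)
      ≈⟨ sumBelow-+ N A (λ p → B (suc p)) ⟨
    ∑[ p < N ] (A p + B (suc p))
      ≈⟨ sumBelow-cong N (λ p _ → recurrence p) ⟩
    ∑[ p < N ] (a (suc q) (suc p) * e (suc p))
      ≈⟨ +-identityˡ _ ⟨
    0# + ∑[ p < N ] (a (suc q) (suc p) * e (suc p))
      ≈⟨ +-congʳ (fromℕ-vanishes (e 0) (scaledStirling-suc-zero q)) ⟨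
    ∑[ p < suc N ] (a (suc q) p * e p) ∎
    where
    N : ℕ
    N = length gs
    Y : Carrier
    Y = shiftedSum gs
    e : ℕ → Carrier
    e = pfisterSum gs
    a : ℕ → ℕ → Carrier
    a q p = fromℕ (scaledStirling q p)
    A B : ℕ → Carrier
    A p = a q p * (fromℕ (suc p) * e (suc p))
    B p = a q p * ((fromℕ p + fromℕ p) * e p)
    raise : ∀ p → Y * (a q p * e p) ≈ A p + B p
    raise p = begin
      Y * (a q p * e p)   ≈⟨ x∙yz≈y∙xz Y (a q p) (e p) ⟩
      a q p * (Y * e p)   ≈⟨ *-congˡ (shiftedSum-*-pfisterSum gs gs² p) ⟩
      a q p * (fromℕ (suc p) * e (suc p) + (fromℕ p + fromℕ p) * e p) ≈⟨ distribˡ _ _ _ ⟩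
      A p + B p           ∎
    A-top≈0 : A N ≈ 0#
    A-top≈0 = trans (*-congˡ (*-pfisterSum-vanishes (fromℕ (suc N)) gs (suc N) ℕ.≤-refl)) (zeroʳ (a q N))
    B₀≈0 : B 0 ≈ 0#
    B₀≈0 = trans (*-congˡ (trans (*-congʳ (+-identityˡ 0#)) (zeroˡ _))) (zeroʳ _)
    recurrence : ∀ p → A p + B (suc p) ≈ a (suc q) (suc p) * e (suc p)
    recurrence p = begin
      a q p * (s * e (suc p)) + a q (suc p) * ((s + s) * e (suc p))
        ≈⟨ solve 4 (λ x s y e → x :* (s :* e) :+ y :* ((s :+ s) :* e) := (s :* x :+ (s :+ s) :* y) :* e)
             refl (a q p) s (a q (suc p)) (e (suc p)) ⟩
      (s * a q p + (s + s) * a q (suc p)) * e (suc p)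
        ≈⟨ *-congʳ coefficient ⟨
      fromℕ (suc p ℕ.* α ℕ.+ (suc p ℕ.+ suc p) ℕ.* β) * e (suc p)
        ≡⟨ ≡.cong (λ m → fromℕ m * e (suc p)) (scaledStirling-suc-suc q p) ⟨
      a (suc q) (suc p) * e (suc p) ∎
      where
      s : Carrier
      s = fromℕ (suc p)
      α β : ℕ
      α = scaledStirling q p
      β = scaledStirling q (suc p)
      coefficient : fromℕ (suc p ℕ.* α ℕ.+ (suc p ℕ.+ suc p) ℕ.* β) ≈ s * a q p + (s + s) * a q (suc p)
      coefficient = begin
        fromℕ (suc p ℕ.* α ℕ.+ (suc p ℕ.+ suc p) ℕ.* β)
          ≈⟨ fromℕ-+ (suc p ℕ.* α) _ ⟩
        fromℕ (suc p ℕ.* α) + fromℕ ((suc p ℕ.+ suc p) ℕ.* β)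
          ≈⟨ +-cong (fromℕ-* (suc p) α) (fromℕ-* (suc p ℕ.+ suc p) β) ⟩
        s * a q p + fromℕ (suc p ℕ.+ suc p) * a q (suc p)
          ≈⟨ +-congˡ (*-congʳ (fromℕ-+ (suc p) (suc p))) ⟩
        s * a q p + (s + s) * a q (suc p) ∎

module PolynomialExpansion {r ℓ} (R : CommutativeRing r ℓ) where

  open CommutativeRing R hiding (zero)
  open IntegerCoefficients R
  open RangeSums R
  open PfisterCalculus R
  open ℤ-Solver using (solve; _:+_; _:*_; :-_; _:=_)
  open import Algebra.Properties.Semiring.Exp semiring using (_^_; ^-congˡ)
  import Algebra.Properties.Semiring.Binomial semiring as Binomial
  open import Algebra.Properties.CommutativeSemigroup *-commutativeSemigroup using (x∙yz≈y∙xz; x∙yz≈xz∙y)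
  open import Relation.Binary.Reasoning.Setoid setoid

  evaluate : List ℤ → Carrier → Carrier
  evaluate cs x = sumList (map (λ i → coeff cs (suc i) ×ℤ x ^ suc i) (upTo (length cs)))

  pfisterExpansion : List ℤ → List Carrier → Carrier
  pfisterExpansion cs gs =
    sumList (map (λ p → bigCoeff (length gs) cs p ×ℤ pfisterSum gs p) (upTo (suc (length gs))))

  evaluate≈sumBelow : ∀ cs x B → length cs < B →
    evaluate cs x ≈ ∑[ t < B ] (fromℤ (coeff cs t) * x ^ t)
  evaluate≈sumBelow cs x B |cs|<B = begin
    evaluate cs x                            ≡⟨ sumList-upTo d _ ⟩
    ∑[ i < d ] (coeff cs (suc i) ×ℤ x ^ suc i) ≈⟨ +-identityˡ _ ⟨
    ∑[ t < suc d ] (coeff cs t ×ℤ x ^ t)     ≈⟨ sumBelow-extend (suc d) B _ |cs|<B vanishes ⟩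
    ∑[ t < B ] (coeff cs t ×ℤ x ^ t)         ≈⟨ sumBelow-cong B (λ t _ → ×ℤ≈fromℤ* (coeff cs t) (x ^ t)) ⟩
    ∑[ t < B ] (fromℤ (coeff cs t) * x ^ t)  ∎
    where
    d : ℕ
    d = length cs
    vanishes : ∀ t → suc d ≤ t → coeff cs t ×ℤ x ^ t ≈ 0#
    vanishes t d<t = reflexive (≡.cong (_×ℤ x ^ t) (coeff-length< cs t d<t))

  binomial-sumBelow : ∀ x y t B → t < B →
    (x + y) ^ t ≈ ∑[ q < B ] (fromℕ (t C q) * (x ^ q * y ^ (t ∸ q)))
  binomial-sumBelow x y t B t<B = begin
    (x + y) ^ t                              ≈⟨ Binomial.theorem x y (*-comm x y) t ⟩
    ∑[ q < suc t ] ((t C q) × term q)        ≈⟨ sumBelow-cong (suc t) (λ q _ → ×≈fromℕ* (t C q) (term q)) ⟩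
    ∑[ q < suc t ] (fromℕ (t C q) * term q)  ≈⟨ sumBelow-extend (suc t) B _ t<B
                                                  (λ q t<q → fromℕ-vanishes (term q) (k>n⇒nCk≡0 t<q)) ⟩
    ∑[ q < B ] (fromℕ (t C q) * term q)      ∎
    where
    open import Algebra.Properties.Semiring.Mult semiring using (_×_)
    term : ℕ → Carrier
    term q = x ^ q * y ^ (t ∸ q)

  stirlingCoeff : ℕ → ℕ → Carrier
  stirlingCoeff q p = fromℕ (scaledStirling q p)

  shiftCoeff : ℕ → ℕ → ℕ → Carrier
  shiftCoeff n t q = fromℕ (t C q) * fromℤ (ℤ.- (+ n)) ^ (t ∸ q)

  fromℤ-bigCoeff : ∀ n cs p B → length cs < B →
    fromℤ (bigCoeff n cs p)
      ≈ ∑[ q < B ] ∑[ t < B ] (stirlingCoeff q p * shiftCoeff n t q * fromℤ (coeff cs t))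
  fromℤ-bigCoeff n cs p B d<B = begin
    fromℤ (sumFromTo p d (λ q → sumFromTo q d (G q)))
      ≈⟨ fromℤ-sumFromTo-extend p d B (λ q → sumFromTo q d (G q)) d<B outer-below outer-above ⟩
    ∑[ q < B ] fromℤ (sumFromTo q d (G q))
      ≈⟨ sumBelow-cong B (λ q _ → inner q) ⟩
    ∑[ q < B ] ∑[ t < B ] K q t ∎
    where
    d : ℕ
    d = length cs
    zℤ : ℤ
    zℤ = ℤ.- (+ n)
    G : ℕ → ℕ → ℤ
    G q t = + (scaledStirling q p ℕ.* (t C q)) ℤ.* zℤ ℤ.^ (t ∸ q) ℤ.* coeff cs t
    K : ℕ → ℕ → Carrier
    K q t = stirlingCoeff q p * shiftCoeff n t q * fromℤ (coeff cs t)
    fromℤ-G : ∀ q t → fromℤ (G q t) ≈ K q t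
    fromℤ-G q t = begin
      fromℤ (G q t)
        ≈⟨ fromℤ-* (+ (α ℕ.* (t C q)) ℤ.* zℤ ℤ.^ k) (coeff cs t) ⟩
      fromℤ (+ (α ℕ.* (t C q)) ℤ.* zℤ ℤ.^ k) * c
        ≈⟨ *-congʳ (fromℤ-* (+ (α ℕ.* (t C q))) (zℤ ℤ.^ k)) ⟩
      fromℕ (α ℕ.* (t C q)) * fromℤ (zℤ ℤ.^ k) * c
        ≈⟨ *-congʳ (*-cong (fromℕ-* α (t C q)) (fromℤ-^ zℤ k)) ⟩
      fromℕ α * fromℕ (t C q) * fromℤ zℤ ^ k * c
        ≈⟨ *-congʳ (*-assoc _ _ _) ⟩
      K q t ∎
      where
      α k : ℕ
      α = scaledStirling q p
      k = t ∸ q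
      c : Carrier
      c = fromℤ (coeff cs t)
    outer-below : ∀ q → q < p → fromℤ (sumFromTo q d (G q)) ≈ 0#
    outer-below q q<p = trans (fromℤ-sumFromTo q d (G q)) (sumBelow-zero (suc d ∸ q) (λ i _ →
      trans (fromℤ-G q (q ℕ.+ i))
            (trans (*-congʳ (fromℕ-vanishes _ (scaledStirling-vanishes q p q<p))) (zeroˡ _))))
    outer-above : ∀ q → d < q → fromℤ (sumFromTo q d (G q)) ≈ 0#
    outer-above q d<q = trans (fromℤ-sumFromTo q d (G q))
      (reflexive (≡.cong (λ m → ∑[ i < m ] fromℤ (G q (q ℕ.+ i))) (ℕ.m≤n⇒m∸n≡0 d<q)))
    inner : ∀ q → fromℤ (sumFromTo q d (G q)) ≈ ∑[ t < B ] K q t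
    inner q = trans (fromℤ-sumFromTo-extend q d B (G q) d<B below above)
                    (sumBelow-cong B (λ t _ → fromℤ-G q t))
      where
      below : ∀ t → t < q → fromℤ (G q t) ≈ 0#
      below t t<q = trans (fromℤ-G q t)
        (trans (*-congʳ (trans (*-congˡ (fromℕ-vanishes _ (k>n⇒nCk≡0 t<q))) (zeroʳ _))) (zeroˡ _))
      above : ∀ t → d < t → fromℤ (G q t) ≈ 0#
      above t d<t = trans (fromℤ-G q t)
        (trans (*-congˡ (reflexive (≡.cong fromℤ (coeff-length< cs t d<t)))) (zeroʳ _))

  module _ (gs : List Carrier) (gs² : All SquaresToOne gs) where

    private
      n : ℕ
      n = length gs
      e : ℕ → Carrier
      e = pfisterSum gs

    shiftedSum-^-extend : ∀ q B → n < B → shiftedSum gs ^ q ≈ ∑[ p < B ] (stirlingCoeff q p * e p)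
    shiftedSum-^-extend q B n<B = trans (shiftedSum-^ gs gs² q)
      (sumBelow-extend (suc n) B _ n<B (λ p → *-pfisterSum-vanishes (stirlingCoeff q p) gs p))

    sum≈shiftedSum-length : sumList gs ≈ shiftedSum gs + fromℤ (ℤ.- (+ n))
    sum≈shiftedSum-length = begin
      sumList gs
        ≈⟨ solve 2 (λ m s → s := (m :+ s) :+ :- m) refl (fromℕ n) (sumList gs) ⟩
      (fromℕ n + sumList gs) + - fromℕ n
        ≈⟨ +-cong (shiftedSum≈length+sum gs) (fromℤ-neg (+ n)) ⟨
      shiftedSum gs + fromℤ (ℤ.- (+ n)) ∎

    sumList-^ : ∀ t B → t < B → n < B →
      sumList gs ^ t ≈ ∑[ q < B ] (shiftCoeff n t q * ∑[ p < B ] (stirlingCoeff q p * e p))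
    sumList-^ t B t<B n<B = begin
      sumList gs ^ t                                      ≈⟨ ^-congˡ t sum≈shiftedSum-length ⟩
      (Y + z) ^ t                                         ≈⟨ binomial-sumBelow Y z t B t<B ⟩
      ∑[ q < B ] (fromℕ (t C q) * (Y ^ q * z ^ (t ∸ q)))  ≈⟨ sumBelow-cong B (λ q _ → expand q) ⟩
      ∑[ q < B ] (shiftCoeff n t q * ∑[ p < B ] (stirlingCoeff q p * e p)) ∎
      where
      Y z : Carrier
      Y = shiftedSum gs
      z = fromℤ (ℤ.- (+ n))
      expand : ∀ q → fromℕ (t C q) * (Y ^ q * z ^ (t ∸ q))
                       ≈ shiftCoeff n t q * ∑[ p < B ] (stirlingCoeff q p * e p)
      expand q = trans (x∙yz≈xz∙y (fromℕ (t C q)) (Y ^ q) (z ^ (t ∸ q)))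
                       (*-congˡ (shiftedSum-^-extend q B n<B))

    pfisterExpansion≈sumBelow : ∀ cs B → n < B →
      pfisterExpansion cs gs ≈ ∑[ p < B ] (fromℤ (bigCoeff n cs p) * e p)
    pfisterExpansion≈sumBelow cs B n<B = begin
      pfisterExpansion cs gs
        ≡⟨ sumList-upTo (suc n) _ ⟩
      ∑[ p < suc n ] (bigCoeff n cs p ×ℤ e p)
        ≈⟨ sumBelow-cong (suc n) (λ p _ → ×ℤ≈fromℤ* (bigCoeff n cs p) (e p)) ⟩
      ∑[ p < suc n ] (fromℤ (bigCoeff n cs p) * e p)
        ≈⟨ sumBelow-extend (suc n) B _ n<B (λ p → *-pfisterSum-vanishes (fromℤ (bigCoeff n cs p)) gs p) ⟩
      ∑[ p < B ] (fromℤ (bigCoeff n cs p) * e p) ∎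

    evaluate≈pfisterExpansion : ∀ cs {x} → x ≈ sumList gs → evaluate cs x ≈ pfisterExpansion cs gs
    evaluate≈pfisterExpansion cs {x} x≈∑gs = begin
      evaluate cs x
        ≈⟨ evaluate≈sumBelow cs x B d<B ⟩
      ∑[ t < B ] (c t * x ^ t)
        ≈⟨ sumBelow-cong B expand-power ⟩
      ∑[ t < B ] (c t * ∑[ q < B ] (shiftCoeff n t q * ∑[ p < B ] (stirlingCoeff q p * e p)))
        ≈⟨ sumBelow-reorder₃ B c (shiftCoeff n) stirlingCoeff e ⟩
      ∑[ p < B ] (∑[ q < B ] ∑[ t < B ] (stirlingCoeff q p * shiftCoeff n t q * c t) * e p)
        ≈⟨ sumBelow-cong B expand-coefficient ⟨
      ∑[ p < B ] (fromℤ (bigCoeff n cs p) * e p)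
        ≈⟨ pfisterExpansion≈sumBelow cs B n<B ⟨
      pfisterExpansion cs gs ∎
      where
      d B : ℕ
      d = length cs
      B = suc (d ℕ.+ n)
      d<B : d < B
      d<B = s≤s (ℕ.m≤m+n d n)
      n<B : n < B
      n<B = s≤s (ℕ.m≤n+m n d)
      c : ℕ → Carrier
      c t = fromℤ (coeff cs t)
      expand-power : ∀ t → t < B →
        c t * x ^ t ≈ c t * ∑[ q < B ] (shiftCoeff n t q * ∑[ p < B ] (stirlingCoeff q p * e p))
      expand-power t t<B = *-congˡ (trans (^-congˡ t x≈∑gs) (sumList-^ t B t<B n<B))
      expand-coefficient : ∀ p → p < B → fromℤ (bigCoeff n cs p) * e p
                             ≈ ∑[ q < B ] ∑[ t < B ] (stirlingCoeff q p * shiftCoeff n t q * c t) * e p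
      expand-coefficient p _ = *-congʳ (fromℤ-bigCoeff n cs p B d<B)

module Matrices {r ℓ} (R : CommutativeRing r ℓ) where

  open CommutativeRing R hiding (zero)
  open Witt R using (δ)
  open import Algebra.Properties.Semiring.Sum semiring
    using (sum; sum-cong-≋; sum-replicate-zero; ∑-comm; *-distribˡ-sum; *-distribʳ-sum)
  import Relation.Binary.Reasoning.Setoid as SetoidReasoning

  private
    variable
      m n k o : ℕ

  Matrix : ℕ → ℕ → Set r
  Matrix m n = Fin m → Fin n → Carrier

  infix 4 _≋_
  _≋_ : Matrix m n → Matrix m n → Set ℓ
  A ≋ B = ∀ i j → A i j ≈ B i j

  ≋-refl : {A : Matrix m n} → A ≋ A
  ≋-refl i j = refl

  ≋-sym : {A B : Matrix m n} → A ≋ B → B ≋ A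
  ≋-sym A≋B i j = sym (A≋B i j)

  ≋-trans : {A B C : Matrix m n} → A ≋ B → B ≋ C → A ≋ C
  ≋-trans A≋B B≋C i j = trans (A≋B i j) (B≋C i j)

  ≋-setoid : ℕ → ℕ → Setoid r ℓ
  ≋-setoid m n = record
    { Carrier = Matrix m n ; _≈_ = _≋_
    ; isEquivalence = record { refl = ≋-refl ; sym = ≋-sym ; trans = ≋-trans } }

  module ≈-Reasoning = SetoidReasoning setoid
  module ≋-Reasoning {m n} = SetoidReasoning (≋-setoid m n)

  infixl 7 _⊛_
  _⊛_ : Matrix m n → Matrix n k → Matrix m k
  _⊛_ {n = n} A B i l = sum {n} (λ j → A i j * B j l)

  I : Matrix n n
  I = δ

  _ᵀ : Matrix m n → Matrix n m
  (A ᵀ) i j = A j i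

  diag : (Fin n → Carrier) → Matrix n n
  diag d i j = d i * δ i j

  δ-sym : ∀ (i j : Fin n) → δ i j ≡ δ j i
  δ-sym zero zero = ≡.refl
  δ-sym zero (suc j) = ≡.refl
  δ-sym (suc i) zero = ≡.refl
  δ-sym (suc i) (suc j) = δ-sym i j

  δ-refl : ∀ (i : Fin n) → δ i i ≡ 1#
  δ-refl zero = ≡.refl
  δ-refl (suc i) = δ-refl i

  δ-≢ : ∀ {i j : Fin n} → i ≢ j → δ i j ≡ 0#
  δ-≢ {i = zero} {zero} i≢j = ⊥-elim (i≢j ≡.refl)
  δ-≢ {i = zero} {suc j} _ = ≡.refl
  δ-≢ {i = suc i} {zero} _ = ≡.refl
  δ-≢ {i = suc i} {suc j} i≢j = δ-≢ (λ i≡j → i≢j (≡.cong suc i≡j))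

  sum-zero : ∀ {f : Fin n → Carrier} → (∀ i → f i ≈ 0#) → sum f ≈ 0#
  sum-zero {n} f≈0 = trans (sum-cong-≋ f≈0) (sum-replicate-zero n)

  ∑-δˡ : ∀ (f : Fin n → Carrier) i → sum (λ j → δ i j * f j) ≈ f i
  ∑-δˡ {suc n} f zero =
    trans (+-cong (*-identityˡ (f zero)) (sum-zero (λ j → zeroˡ (f (suc j))))) (+-identityʳ (f zero))
  ∑-δˡ {suc n} f (suc i) = trans (+-cong (zeroˡ _) (∑-δˡ (λ j → f (suc j)) i)) (+-identityˡ _)

  ∑-δʳ : ∀ (f : Fin n → Carrier) i → sum (λ j → f j * δ j i) ≈ f i
  ∑-δʳ f i = trans (sum-cong-≋ (λ j → trans (*-comm (f j) (δ j i)) (*-congʳ (reflexive (δ-sym j i)))))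
                   (∑-δˡ f i)

  ⊛-cong : {A A′ : Matrix m n} {B B′ : Matrix n k} → A ≋ A′ → B ≋ B′ → A ⊛ B ≋ A′ ⊛ B′
  ⊛-cong A≋A′ B≋B′ i l = sum-cong-≋ (λ j → *-cong (A≋A′ i j) (B≋B′ j l))

  ⊛-assoc : ∀ (A : Matrix m n) (B : Matrix n k) (C : Matrix k o) → (A ⊛ B) ⊛ C ≋ A ⊛ (B ⊛ C)
  ⊛-assoc {n = n} {k = k} A B C i l = begin
    sum {k} (λ j → sum {n} (λ a → A i a * B a j) * C j l)
      ≈⟨ sum-cong-≋ (λ j → *-distribʳ-sum (C j l) (λ a → A i a * B a j)) ⟩
    sum {k} (λ j → sum {n} (λ a → A i a * B a j * C j l))
      ≈⟨ ∑-comm (λ j a → A i a * B a j * C j l) ⟩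
    sum {n} (λ a → sum {k} (λ j → A i a * B a j * C j l))
      ≈⟨ sum-cong-≋ (λ a → sum-cong-≋ (λ j → *-assoc (A i a) (B a j) (C j l))) ⟩
    sum {n} (λ a → sum {k} (λ j → A i a * (B a j * C j l)))
      ≈⟨ sum-cong-≋ (λ a → *-distribˡ-sum (A i a) (λ j → B a j * C j l)) ⟨
    sum {n} (λ a → A i a * sum {k} (λ j → B a j * C j l)) ∎
    where open ≈-Reasoning

  ⊛-identityˡ : ∀ (A : Matrix m n) → I ⊛ A ≋ A
  ⊛-identityˡ A i l = ∑-δˡ (λ j → A j l) i

  ⊛-identityʳ : ∀ (A : Matrix m n) → A ⊛ I ≋ A
  ⊛-identityʳ A i l = ∑-δʳ (A i) l

  ᵀ-⊛ : ∀ (A : Matrix m n) (B : Matrix n k) → (A ⊛ B) ᵀ ≋ B ᵀ ⊛ A ᵀ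
  ᵀ-⊛ A B i l = sum-cong-≋ (λ j → *-comm (A l j) (B j i))

  ᵀ-cong : {A B : Matrix m n} → A ≋ B → A ᵀ ≋ B ᵀ
  ᵀ-cong A≋B i j = A≋B j i

  I-ᵀ : I {n} ᵀ ≋ I
  I-ᵀ i j = reflexive (δ-sym j i)

  diag-⊛ : ∀ (d : Fin m → Carrier) (A : Matrix m n) i l → (diag d ⊛ A) i l ≈ d i * A i l
  diag-⊛ d A i l = begin
    sum (λ j → d i * δ i j * A j l)     ≈⟨ sum-cong-≋ (λ j → *-assoc (d i) (δ i j) (A j l)) ⟩
    sum (λ j → d i * (δ i j * A j l))   ≈⟨ *-distribˡ-sum (d i) (λ j → δ i j * A j l) ⟨
    d i * sum (λ j → δ i j * A j l)     ≈⟨ *-congˡ (∑-δˡ (λ j → A j l) i) ⟩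
    d i * A i l                         ∎
    where open ≈-Reasoning

  diag-cong : ∀ {d e : Fin n → Carrier} → (∀ i → d i ≈ e i) → diag d ≋ diag e
  diag-cong d≈e i j = *-congʳ (d≈e i)

  transform : Matrix m n → Matrix m m → Matrix n n
  transform P D = P ᵀ ⊛ (D ⊛ P)

  transform-diag : ∀ (P : Matrix m n) d j k →
                   transform P (diag d) j k ≈ sum (λ i → P i j * (d i * P i k))
  transform-diag P d j k = sum-cong-≋ (λ i → *-congˡ (diag-⊛ d P i k))

  transform-congˡ : {P P′ : Matrix m n} (D : Matrix m m) → P ≋ P′ → transform P D ≋ transform P′ D
  transform-congˡ D P≋P′ = ⊛-cong (ᵀ-cong P≋P′) (⊛-cong ≋-refl P≋P′)

  transform-congʳ : (P : Matrix m n) {D D′ : Matrix m m} → D ≋ D′ → transform P D ≋ transform P D′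
  transform-congʳ P D≋D′ = ⊛-cong ≋-refl (⊛-cong D≋D′ ≋-refl)

  transform-⊛ : ∀ (A : Matrix m n) (B : Matrix n k) D → transform (A ⊛ B) D ≋ transform B (transform A D)
  transform-⊛ A B D = begin
    (A ⊛ B) ᵀ ⊛ (D ⊛ (A ⊛ B))        ≈⟨ ⊛-cong (ᵀ-⊛ A B) (≋-sym (⊛-assoc D A B)) ⟩
    B ᵀ ⊛ A ᵀ ⊛ (D ⊛ A ⊛ B)          ≈⟨ ⊛-assoc (B ᵀ) (A ᵀ) (D ⊛ A ⊛ B) ⟩
    B ᵀ ⊛ (A ᵀ ⊛ (D ⊛ A ⊛ B))        ≈⟨ ⊛-cong ≋-refl (≋-sym (⊛-assoc (A ᵀ) (D ⊛ A) B)) ⟩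
    B ᵀ ⊛ (A ᵀ ⊛ (D ⊛ A) ⊛ B)        ∎
    where open ≋-Reasoning

  transform-I : ∀ (D : Matrix n n) → transform I D ≋ D
  transform-I D = ≋-trans (⊛-cong I-ᵀ (⊛-identityʳ D)) (⊛-identityˡ D)

  ⊛-inverse : ∀ (A : Matrix m n) A⁻¹ (B : Matrix n k) B⁻¹ →
              A ⊛ A⁻¹ ≋ I → B ⊛ B⁻¹ ≋ I → (A ⊛ B) ⊛ (B⁻¹ ⊛ A⁻¹) ≋ I
  ⊛-inverse A A⁻¹ B B⁻¹ AA⁻¹≋I BB⁻¹≋I = begin
    A ⊛ B ⊛ (B⁻¹ ⊛ A⁻¹)    ≈⟨ ⊛-assoc A B (B⁻¹ ⊛ A⁻¹) ⟩
    A ⊛ (B ⊛ (B⁻¹ ⊛ A⁻¹))  ≈⟨ ⊛-cong ≋-refl (⊛-assoc B B⁻¹ A⁻¹) ⟨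
    A ⊛ (B ⊛ B⁻¹ ⊛ A⁻¹)    ≈⟨ ⊛-cong ≋-refl (⊛-cong BB⁻¹≋I ≋-refl) ⟩
    A ⊛ (I ⊛ A⁻¹)          ≈⟨ ⊛-cong ≋-refl (⊛-identityˡ A⁻¹) ⟩
    A ⊛ A⁻¹                ≈⟨ AA⁻¹≋I ⟩
    I                      ∎
    where open ≋-Reasoning

  record Congruent (D : Matrix m m) (E : Matrix n n) : Set (r ⊔ ℓ) where
    field
      P : Matrix m n
      P⁻¹ : Matrix n m
      P⊛P⁻¹ : P ⊛ P⁻¹ ≋ I
      P⁻¹⊛P : P⁻¹ ⊛ P ≋ I
      transform-P : transform P D ≋ E

  open Congruent

  Congruent-refl : ∀ {D : Matrix n n} → Congruent D D
  Congruent-refl {D = D} = record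
    { P = I ; P⁻¹ = I ; P⊛P⁻¹ = ⊛-identityˡ I ; P⁻¹⊛P = ⊛-identityˡ I
    ; transform-P = transform-I D }

  Congruent-sym : ∀ {D : Matrix m m} {E : Matrix n n} → Congruent D E → Congruent E D
  Congruent-sym {D = D} {E} D≅E = record
    { P = P⁻¹ D≅E ; P⁻¹ = P D≅E ; P⊛P⁻¹ = P⁻¹⊛P D≅E ; P⁻¹⊛P = P⊛P⁻¹ D≅E
    ; transform-P = begin
        transform (P⁻¹ D≅E) E                      ≈⟨ transform-congʳ (P⁻¹ D≅E) (transform-P D≅E) ⟨
        transform (P⁻¹ D≅E) (transform (P D≅E) D)  ≈⟨ transform-⊛ (P D≅E) (P⁻¹ D≅E) D ⟨
        transform (P D≅E ⊛ P⁻¹ D≅E) D              ≈⟨ transform-congˡ D (P⊛P⁻¹ D≅E) ⟩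
        transform I D                              ≈⟨ transform-I D ⟩
        D                                          ∎ }
    where open ≋-Reasoning

  Congruent-trans : ∀ {D : Matrix m m} {E : Matrix n n} {F : Matrix k k} →
                    Congruent D E → Congruent E F → Congruent D F
  Congruent-trans {D = D} D≅E E≅F = record
    { P = P D≅E ⊛ P E≅F ; P⁻¹ = P⁻¹ E≅F ⊛ P⁻¹ D≅E
    ; P⊛P⁻¹ = ⊛-inverse (P D≅E) (P⁻¹ D≅E) (P E≅F) (P⁻¹ E≅F) (P⊛P⁻¹ D≅E) (P⊛P⁻¹ E≅F)
    ; P⁻¹⊛P = ⊛-inverse (P⁻¹ E≅F) (P E≅F) (P⁻¹ D≅E) (P D≅E) (P⁻¹⊛P E≅F) (P⁻¹⊛P D≅E)
    ; transform-P = ≋-trans (transform-⊛ (P D≅E) (P E≅F) D)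
                      (≋-trans (transform-congʳ (P E≅F) (transform-P D≅E)) (transform-P E≅F)) }

  Congruent-resp : ∀ {D D′ : Matrix m m} {E E′ : Matrix n n} →
                   D ≋ D′ → E ≋ E′ → Congruent D E → Congruent D′ E′
  Congruent-resp {D = D} D≋D′ E≋E′ D≅E = record
    { P = P D≅E ; P⁻¹ = P⁻¹ D≅E ; P⊛P⁻¹ = P⊛P⁻¹ D≅E ; P⁻¹⊛P = P⁻¹⊛P D≅E
    ; transform-P = ≋-trans (transform-congʳ (P D≅E) (≋-sym D≋D′)) (≋-trans (transform-P D≅E) E≋E′) }

  Congruent-scale : ∀ {D : Matrix m m} {E : Matrix n n} x →
                    Congruent D E → Congruent (λ i j → x * D i j) (λ i j → x * E i j)
  Congruent-scale {m} {n} {D = D} x D≅E = record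
    { P = P D≅E ; P⁻¹ = P⁻¹ D≅E ; P⊛P⁻¹ = P⊛P⁻¹ D≅E ; P⁻¹⊛P = P⁻¹⊛P D≅E
    ; transform-P = λ j k → trans (scale j k) (*-congˡ (transform-P D≅E j k)) }
    where
    Pm : Matrix m n
    Pm = P D≅E
    scale : ∀ j k → transform Pm (λ i l → x * D i l) j k ≈ x * transform Pm D j k
    scale j k = begin
      sum (λ i → Pm i j * sum (λ l → x * D i l * Pm l k))
        ≈⟨ sum-cong-≋ (λ i → *-congˡ (sum-cong-≋ (λ l → *-assoc x (D i l) (Pm l k)))) ⟩
      sum (λ i → Pm i j * sum (λ l → x * (D i l * Pm l k)))
        ≈⟨ sum-cong-≋ (λ i → *-congˡ (*-distribˡ-sum x (λ l → D i l * Pm l k))) ⟨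
      sum (λ i → Pm i j * (x * (D ⊛ Pm) i k))
        ≈⟨ sum-cong-≋ (λ i → x∙yz≈y∙xz (Pm i j) x ((D ⊛ Pm) i k)) ⟩
      sum (λ i → x * (Pm i j * (D ⊛ Pm) i k))
        ≈⟨ *-distribˡ-sum x (λ i → Pm i j * (D ⊛ Pm) i k) ⟨
      x * transform Pm D j k ∎
      where
      open ≈-Reasoning
      open import Algebra.Properties.CommutativeSemigroup *-commutativeSemigroup using (x∙yz≈y∙xz)

  extend : Carrier → Matrix m n → Matrix (suc m) (suc n)
  extend x A zero zero = x
  extend x A zero (suc j) = 0#
  extend x A (suc i) zero = 0#
  extend x A (suc i) (suc j) = A i j

  extend-cong : ∀ {x y} {A B : Matrix m n} → x ≈ y → A ≋ B → extend x A ≋ extend y B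
  extend-cong x≈y A≋B zero zero = x≈y
  extend-cong x≈y A≋B zero (suc j) = refl
  extend-cong x≈y A≋B (suc i) zero = refl
  extend-cong x≈y A≋B (suc i) (suc j) = A≋B i j

  extend-ᵀ : ∀ x (A : Matrix m n) → extend x A ᵀ ≋ extend x (A ᵀ)
  extend-ᵀ x A zero zero = refl
  extend-ᵀ x A zero (suc j) = refl
  extend-ᵀ x A (suc i) zero = refl
  extend-ᵀ x A (suc i) (suc j) = refl

  extend-I : extend 1# (I {n}) ≋ I
  extend-I zero zero = refl
  extend-I zero (suc j) = refl
  extend-I (suc i) zero = refl
  extend-I (suc i) (suc j) = refl

  extend-⊛ : ∀ x y (A : Matrix m n) (B : Matrix n k) → extend x A ⊛ extend y B ≋ extend (x * y) (A ⊛ B)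
  extend-⊛ {n = n} x y A B zero zero =
    trans (+-congˡ (sum-zero {n} (λ j → zeroˡ 0#))) (+-identityʳ (x * y))
  extend-⊛ x y A B zero (suc l) =
    trans (+-cong (zeroʳ x) (sum-zero (λ j → zeroˡ (B j l)))) (+-identityʳ 0#)
  extend-⊛ x y A B (suc i) zero =
    trans (+-cong (zeroˡ y) (sum-zero (λ j → zeroʳ (A i j)))) (+-identityʳ 0#)
  extend-⊛ x y A B (suc i) (suc l) =
    trans (+-congʳ (zeroˡ 0#)) (+-identityˡ ((A ⊛ B) i l))

  Congruent-extend : ∀ {x y} {D : Matrix m m} {E : Matrix n n} →
                     x ≈ y → Congruent D E → Congruent (extend x D) (extend y E)
  Congruent-extend {m} {n} {x} {y} {D} {E} x≈y D≅E = record
    { P = extend 1# Pm ; P⁻¹ = extend 1# (P⁻¹ D≅E)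
    ; P⊛P⁻¹ = inverse (P⊛P⁻¹ D≅E)
    ; P⁻¹⊛P = inverse (P⁻¹⊛P D≅E)
    ; transform-P = begin
        extend 1# Pm ᵀ ⊛ (extend x D ⊛ extend 1# Pm)  ≈⟨ ⊛-cong (extend-ᵀ 1# Pm) (extend-⊛ x 1# D Pm) ⟩
        extend 1# (Pm ᵀ) ⊛ extend (x * 1#) (D ⊛ Pm)   ≈⟨ extend-⊛ 1# (x * 1#) (Pm ᵀ) (D ⊛ Pm) ⟩
        extend (1# * (x * 1#)) (transform Pm D)        ≈⟨ extend-cong 1x1≈y (transform-P D≅E) ⟩
        extend y E                                     ∎ }
    where
    open ≋-Reasoning
    Pm : Matrix m n
    Pm = P D≅E
    1x1≈y : 1# * (x * 1#) ≈ y
    1x1≈y = trans (*-identityˡ (x * 1#)) (trans (*-identityʳ x) x≈y)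
    inverse : ∀ {k l} {A : Matrix k l} {B : Matrix l k} → A ⊛ B ≋ I → extend 1# A ⊛ extend 1# B ≋ I
    inverse {A = A} {B} A⊛B≋I =
      ≋-trans (extend-⊛ 1# 1# A B) (≋-trans (extend-cong (*-identityˡ 1#) A⊛B≋I) extend-I)

  private
    δ-permute : ∀ (π : Permutation n m) i j → δ (π ⟨$⟩ʳ i) (π ⟨$⟩ʳ j) ≡ δ i j
    δ-permute π i j with i ≟ j
    ... | yes ≡.refl = ≡.trans (δ-refl (π ⟨$⟩ʳ i)) (≡.sym (δ-refl i))
    ... | no i≢j = ≡.trans (δ-≢ πi≢πj) (≡.sym (δ-≢ i≢j))
      where
      πi≢πj : π ⟨$⟩ʳ i ≢ π ⟨$⟩ʳ j
      πi≢πj πi≡πj = i≢j (≡.trans (≡.sym (Perm.inverseˡ π))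
                                 (≡.trans (≡.cong (π ⟨$⟩ˡ_) πi≡πj) (Perm.inverseˡ π)))

  permutationMatrix : Permutation n m → Matrix m n
  permutationMatrix π i j = δ i (π ⟨$⟩ʳ j)

  Congruent-permute : ∀ (π : Permutation n m) (d : Fin m → Carrier) →
                      Congruent (diag d) (diag (λ i → d (π ⟨$⟩ʳ i)))
  Congruent-permute {n} {m} π d = record
    { P = Pπ ; P⁻¹ = Pπ ᵀ ; P⊛P⁻¹ = orthogonalʳ ; P⁻¹⊛P = orthogonalˡ
    ; transform-P = λ j k → begin
        transform Pπ (diag d) j k                    ≈⟨ transform-diag Pπ d j k ⟩
        sum (λ i → δ i (π ⟨$⟩ʳ j) * (d i * Pπ i k))  ≈⟨ ∑-δʳ′ (λ i → d i * Pπ i k) (π ⟨$⟩ʳ j) ⟩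
        d (π ⟨$⟩ʳ j) * δ (π ⟨$⟩ʳ j) (π ⟨$⟩ʳ k)     ≡⟨ ≡.cong (d (π ⟨$⟩ʳ j) *_) (δ-permute π j k) ⟩
        d (π ⟨$⟩ʳ j) * δ j k                         ∎ }
    where
    open ≈-Reasoning
    open import Algebra.Properties.Semiring.Sum semiring using (∑-permute)
    Pπ : Matrix m n
    Pπ = permutationMatrix π
    ∑-δʳ′ : ∀ (f : Fin m → Carrier) k → sum (λ i → δ i k * f i) ≈ f k
    ∑-δʳ′ f k = trans (sum-cong-≋ (λ i → *-comm (δ i k) (f i))) (∑-δʳ f k)
    orthogonalʳ : Pπ ⊛ Pπ ᵀ ≋ I
    orthogonalʳ i i′ = begin
      sum (λ j → δ i (π ⟨$⟩ʳ j) * δ i′ (π ⟨$⟩ʳ j))   ≈⟨ ∑-permute (λ l → δ i l * δ i′ l) π ⟨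
      sum (λ l → δ i l * δ i′ l)                      ≈⟨ ∑-δˡ (δ i′) i ⟩
      δ i′ i                                          ≡⟨ δ-sym i′ i ⟩
      δ i i′                                          ∎
    orthogonalˡ : Pπ ᵀ ⊛ Pπ ≋ I
    orthogonalˡ j j′ = begin
      sum (λ i → δ i (π ⟨$⟩ʳ j) * δ i (π ⟨$⟩ʳ j′))   ≈⟨ ∑-δʳ′ (λ i → δ i (π ⟨$⟩ʳ j′)) (π ⟨$⟩ʳ j) ⟩
      δ (π ⟨$⟩ʳ j) (π ⟨$⟩ʳ j′)                        ≡⟨ δ-permute π j j′ ⟩
      δ j j′                                          ∎

  Congruent-diag-scale : ∀ x {d : Fin m → Carrier} {e : Fin n → Carrier} →
    Congruent (diag d) (diag e) → Congruent (diag (λ i → x * d i)) (diag (λ j → x * e j))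
  Congruent-diag-scale x {d} {e} =
    Congruent-resp (λ i j → sym (*-assoc x (d i) (δ i j))) (λ i j → sym (*-assoc x (e i) (δ i j)))
    ∘ Congruent-scale x

  Congruent-diag-cast : ∀ {m′ n′} {d : Fin m → Carrier} {e : Fin n → Carrier}
                        (m′≡m : m′ ≡ m) (n′≡n : n′ ≡ n) →
    Congruent (diag d) (diag e) →
    Congruent (diag (λ i → d (cast m′≡m i))) (diag (λ j → e (cast n′≡n j)))
  Congruent-diag-cast {d = d} {e} ≡.refl ≡.refl =
    Congruent-resp (diag-cong (λ i → reflexive (≡.cong d (≡.sym (cast-is-id ≡.refl i)))))
                   (diag-cong (λ j → reflexive (≡.cong e (≡.sym (cast-is-id ≡.refl j)))))

module DiagonalForms {r ℓ} (F : CommutativeRing r ℓ) where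

  open CommutativeRing F hiding (zero) renaming (Carrier to K)
  open Witt F
  open Matrices F
  open import Data.Product using (_×_)
  open IntegerCoefficients F using (module ℤ-Solver)
  open ℤ-Solver using (Polynomial; solve; _:+_; _:*_; _:-_; :-_; _:=_; con)
  open import Algebra.Properties.Semiring.Sum semiring using (sum)
  open import Data.List.Relation.Binary.Permutation.Setoid setoid using (_↭_)
  import Data.List.Relation.Binary.Permutation.Setoid.Properties setoid as ↭
  open import Relation.Binary.Reasoning.Setoid setoid

  IsUnit : K → Set (r ⊔ ℓ)
  IsUnit x = ∃ λ y → x * y ≈ 1#

  TwoIsUnit : Set (r ⊔ ℓ)
  TwoIsUnit = IsUnit (1# + 1#)

  IsUnit-* : ∀ {x y} → IsUnit x → IsUnit y → IsUnit (x * y)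
  IsUnit-* {x} {y} (x⁻¹ , xx⁻¹≈1) (y⁻¹ , yy⁻¹≈1) = x⁻¹ * y⁻¹ ,
    trans (solve 4 (λ x y x⁻¹ y⁻¹ → (x :* y) :* (x⁻¹ :* y⁻¹) := (x :* x⁻¹) :* (y :* y⁻¹)) refl x y x⁻¹ y⁻¹)
          (trans (*-cong xx⁻¹≈1 yy⁻¹≈1) (*-identityʳ 1#))

  IsUnit-neg : ∀ {x} → IsUnit x → IsUnit (- x)
  IsUnit-neg {x} (x⁻¹ , xx⁻¹≈1) =
    - x⁻¹ , trans (solve 2 (λ x x⁻¹ → :- x :* :- x⁻¹ := x :* x⁻¹) refl x x⁻¹) xx⁻¹≈1

  -- A record rather than a synonym, so that φ and ψ stay inferable from the type.
  infix 4 _≅_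
  record _≅_ (φ ψ : Form) : Set (r ⊔ ℓ) where
    constructor congruence
    field gram-congruent : Congruent (diag (lookupF φ)) (diag (lookupF ψ))

  open _≅_

  ΣF≡sum : ∀ n (f : Fin n → K) → ΣF n f ≡ sum f
  ΣF≡sum zero f = ≡.refl
  ΣF≡sum (suc n) f = ≡.cong (λ s → f zero + s) (ΣF≡sum n (λ i → f (suc i)))

  ≅⇒Isometric : ∀ {φ ψ} → φ ≅ ψ → Isometric φ ψ
  ≅⇒Isometric {φ} {ψ} (congruence φ≅ψ) =
    P , P⁻¹ ,
    (λ i i′ → trans (reflexive (ΣF≡sum (length ψ) _)) (P⊛P⁻¹ i i′)) ,
    (λ j j′ → trans (reflexive (ΣF≡sum (length φ) _)) (P⁻¹⊛P j j′)) ,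
    (λ j k → trans (reflexive (ΣF≡sum (length φ) _))
                   (trans (sym (transform-diag P (lookupF φ) j k)) (transform-P j k)))
    where open Congruent φ≅ψ

  ≅-refl : ∀ {φ} → φ ≅ φ
  ≅-refl = congruence Congruent-refl

  ≅-sym : ∀ {φ ψ} → φ ≅ ψ → ψ ≅ φ
  ≅-sym (congruence φ≅ψ) = congruence (Congruent-sym φ≅ψ)

  ≅-trans : ∀ {φ ψ χ} → φ ≅ ψ → ψ ≅ χ → φ ≅ χ
  ≅-trans (congruence φ≅ψ) (congruence ψ≅χ) = congruence (Congruent-trans φ≅ψ ψ≅χ)

  ≅-reflexive : ∀ {φ ψ} → φ ≡ ψ → φ ≅ ψ
  ≅-reflexive ≡.refl = ≅-refl

  private
    diag-cons : ∀ x φ → diag (lookupF (x ∷ φ)) ≋ extend x (diag (lookupF φ))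
    diag-cons x φ zero zero = *-identityʳ x
    diag-cons x φ zero (suc j) = zeroʳ x
    diag-cons x φ (suc i) zero = zeroʳ (lookupF φ i)
    diag-cons x φ (suc i) (suc j) = refl

  ≅-cons : ∀ {x y φ ψ} → x ≈ y → φ ≅ ψ → x ∷ φ ≅ y ∷ ψ
  ≅-cons {x} {y} {φ} {ψ} x≈y (congruence φ≅ψ) = congruence
    (Congruent-resp (≋-sym (diag-cons x φ)) (≋-sym (diag-cons y ψ)) (Congruent-extend x≈y φ≅ψ))

  lookupF-map : ∀ (f : K → K) φ i → lookupF (map f φ) i ≡ f (lookupF φ (cast (List.length-map f φ) i))
  lookupF-map f (a ∷ φ) zero = ≡.refl
  lookupF-map f (a ∷ φ) (suc i) = lookupF-map f φ i

  ≅-scale : ∀ x {φ ψ} → φ ≅ ψ → map (x *_) φ ≅ map (x *_) ψ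
  ≅-scale x {φ} {ψ} (congruence φ≅ψ) = congruence
    (Congruent-resp (diag-cong (λ i → reflexive (≡.sym (lookupF-map (x *_) φ i))))
                    (diag-cong (λ j → reflexive (≡.sym (lookupF-map (x *_) ψ j))))
      (Congruent-diag-cast (List.length-map (x *_) φ) (List.length-map (x *_) ψ)
        (Congruent-diag-scale x φ≅ψ)))

  lookupF≡lookup : ∀ φ i → lookupF φ i ≡ lookup φ i
  lookupF≡lookup (a ∷ φ) zero = ≡.refl
  lookupF≡lookup (a ∷ φ) (suc i) = lookupF≡lookup φ i

  ≅-↭ : ∀ {φ ψ} → φ ↭ ψ → φ ≅ ψ
  ≅-↭ {φ} {ψ} φ↭ψ = ≅-sym (congruence
    (Congruent-resp ≋-refl (diag-cong permuted) (Congruent-permute π (lookupF ψ))))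
    where
    π : Permutation (length φ) (length ψ)
    π = Homogeneous.onIndices φ↭ψ
    permuted : ∀ i → lookupF ψ (π ⟨$⟩ʳ i) ≈ lookupF φ i
    permuted i = sym (begin
      lookupF φ i            ≡⟨ lookupF≡lookup φ i ⟩
      lookup φ i             ≈⟨ ↭.onIndices-lookup φ↭ψ i ⟩
      lookup ψ (π ⟨$⟩ʳ i)    ≡⟨ lookupF≡lookup ψ (π ⟨$⟩ʳ i) ⟨
      lookupF ψ (π ⟨$⟩ʳ i)   ∎)

  ≅-pointwise : ∀ {φ ψ} → Pointwise _≈_ φ ψ → φ ≅ ψ
  ≅-pointwise φ≈ψ = ≅-↭ (Homogeneous.refl φ≈ψ)

  ≅-++ˡ : ∀ γ {φ ψ} → φ ≅ ψ → γ ++ φ ≅ γ ++ ψ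
  ≅-++ˡ [] φ≅ψ = φ≅ψ
  ≅-++ˡ (x ∷ γ) φ≅ψ = ≅-cons refl (≅-++ˡ γ φ≅ψ)

  ≅-++ʳ : ∀ γ {φ ψ} → φ ≅ ψ → φ ++ γ ≅ ψ ++ γ
  ≅-++ʳ γ {φ} {ψ} φ≅ψ =
    ≅-trans (≅-↭ (↭.++-comm φ γ)) (≅-trans (≅-++ˡ γ φ≅ψ) (≅-↭ (↭.++-comm γ ψ)))

  private
    :0 :1 : ∀ {n} → Polynomial n
    :0 = con (+ 0)
    :1 = con (+ 1)

  ≅-square : ∀ {a} → IsUnit a → a * a ∷ [] ≅ ⟨1⟩
  ≅-square {a} (u , au≈1) = congruence (record
    { P = Pm ; P⁻¹ = Qm ; P⊛P⁻¹ = PQ ; P⁻¹⊛P = QP ; transform-P = PDP })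
    where
    Pm Qm : Matrix 1 1
    Pm _ _ = u
    Qm _ _ = a
    PQ : Pm ⊛ Qm ≋ I
    PQ zero zero = trans (+-identityʳ _) (trans (*-comm u a) au≈1)
    QP : Qm ⊛ Pm ≋ I
    QP zero zero = trans (+-identityʳ _) au≈1
    PDP : transform Pm (diag (lookupF (a * a ∷ []))) ≋ diag (lookupF ⟨1⟩)
    PDP zero zero = begin
      transform Pm (diag (lookupF (a * a ∷ []))) zero zero
        ≈⟨ transform-diag Pm (lookupF (a * a ∷ [])) zero zero ⟩
      u * (a * a * u) + 0#
        ≈⟨ solve 2 (λ a u → u :* (a :* a :* u) :+ :0 := (a :* u) :* (a :* u)) refl a u ⟩
      (a * u) * (a * u)
        ≈⟨ *-cong au≈1 au≈1 ⟩
      1# * 1# ∎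

  -- The columns (p, q) and (q, p), with p = (1 + a⁻¹)/2 and q = (1 − a⁻¹)/2, form a hyperbolic
  -- basis of ⟨a, −a⟩; the polynomial copies P̂, Q̂ of the matrices let the solver check each entry.
  ≅-hyperbolic : TwoIsUnit → ∀ {a} → IsUnit a → a ∷ - a ∷ [] ≅ ℍ
  ≅-hyperbolic (h , 2h≈1) {a} (u , au≈1) = congruence (record
    { P = Pm ; P⁻¹ = Qm
    ; P⊛P⁻¹ = λ i j → trans (elim-c (PQ i j)) (*-identityˡ (δ i j))
    ; P⁻¹⊛P = λ i j → trans (elim-c (QP i j)) (*-identityˡ (δ i j))
    ; transform-P = λ i j → trans (transform-diag Pm (lookupF (a ∷ - a ∷ [])) i j) (elim-c (PDP i j)) })
    where
    symmetric₂ : ∀ {b} {A : Set b} → A → A → Fin 2 → Fin 2 → A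
    symmetric₂ α β zero zero = α
    symmetric₂ α β zero (suc zero) = β
    symmetric₂ α β (suc zero) zero = β
    symmetric₂ α β (suc zero) (suc zero) = α

    Pm Qm : Matrix 2 2
    Pm = symmetric₂ (h * (1# + u)) (h * (1# - u))
    Qm = symmetric₂ (a * (h * (1# + u))) (- (a * (h * (1# - u))))

    c : K
    c = (h + h) * (h + h) * (a * u)

    elim-c : ∀ {x y z} → x ≈ y * c * z → x ≈ y * z
    elim-c {y = y} x≈ycz = trans x≈ycz (*-congʳ (trans (*-congˡ c≈1) (*-identityʳ y)))
      where
      h+h≈1 : h + h ≈ 1#
      h+h≈1 = trans (solve 1 (λ h → h :+ h := (:1 :+ :1) :* h) refl h) 2h≈1
      c≈1 : c ≈ 1#
      c≈1 = trans (*-cong (*-cong h+h≈1 h+h≈1) au≈1) (trans (*-identityʳ _) (*-identityʳ _))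

    P̂ Q̂ : ∀ {n} → Polynomial n → Polynomial n → Polynomial n → Fin 2 → Fin 2 → Polynomial n
    P̂ a h u = symmetric₂ (h :* (:1 :+ u)) (h :* (:1 :- u))
    Q̂ a h u = symmetric₂ (a :* (h :* (:1 :+ u))) (:- (a :* (h :* (:1 :- u))))
    d̂ : ∀ {n} → Polynomial n → Fin 2 → Polynomial n
    d̂ a zero = a
    d̂ a (suc zero) = :- a
    ℓ̂ : ∀ {n} → Fin 2 → Polynomial n
    ℓ̂ zero = :1
    ℓ̂ (suc zero) = :- :1
    Σ₂ : ∀ {n} → (Fin 2 → Polynomial n) → Polynomial n
    Σ₂ f = f zero :+ (f (suc zero) :+ :0)
    ĉ : ∀ {n} → Polynomial n → Polynomial n → Polynomial n → Polynomial n
    ĉ a h u = (h :+ h) :* (h :+ h) :* (a :* u)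

    PQ-equation QP-equation PDP-equation :
      Fin 2 → Fin 2 → (a h u : Polynomial 3) → Polynomial 3 × Polynomial 3
    PQ-equation i j a h u = Σ₂ (λ k → P̂ a h u i k :* Q̂ a h u k j) := :1 :* ĉ a h u :* symmetric₂ :1 :0 i j
    QP-equation i j a h u = Σ₂ (λ k → Q̂ a h u i k :* P̂ a h u k j) := :1 :* ĉ a h u :* symmetric₂ :1 :0 i j
    PDP-equation i j a h u =
      Σ₂ (λ k → P̂ a h u k i :* (d̂ a k :* P̂ a h u k j)) := ℓ̂ i :* ĉ a h u :* symmetric₂ :1 :0 i j

    PQ : ∀ i j → (Pm ⊛ Qm) i j ≈ 1# * c * δ i j
    PQ zero zero = solve 3 (PQ-equation zero zero) refl a h u
    PQ zero (suc zero) = solve 3 (PQ-equation zero (suc zero)) refl a h u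
    PQ (suc zero) zero = solve 3 (PQ-equation (suc zero) zero) refl a h u
    PQ (suc zero) (suc zero) = solve 3 (PQ-equation (suc zero) (suc zero)) refl a h u

    QP : ∀ i j → (Qm ⊛ Pm) i j ≈ 1# * c * δ i j
    QP zero zero = solve 3 (QP-equation zero zero) refl a h u
    QP zero (suc zero) = solve 3 (QP-equation zero (suc zero)) refl a h u
    QP (suc zero) zero = solve 3 (QP-equation (suc zero) zero) refl a h u
    QP (suc zero) (suc zero) = solve 3 (QP-equation (suc zero) (suc zero)) refl a h u

    PDP : ∀ i j → sum (λ k → Pm k i * (lookupF (a ∷ - a ∷ []) k * Pm k j)) ≈ lookupF ℍ i * c * δ i j
    PDP zero zero = solve 3 (PDP-equation zero zero) refl a h u
    PDP zero (suc zero) = solve 3 (PDP-equation zero (suc zero)) refl a h u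
    PDP (suc zero) zero = solve 3 (PDP-equation (suc zero) zero) refl a h u
    PDP (suc zero) (suc zero) = solve 3 (PDP-equation (suc zero) (suc zero)) refl a h u

module WittRing {r ℓ} (F : CommutativeRing r ℓ) (two-unit : DiagonalForms.TwoIsUnit F) where

  open CommutativeRing F hiding (zero) renaming (Carrier to K)
  open Witt F
  open DiagonalForms F
  open import Algebra.Properties.Ring ring using (-1*x≈-x; -‿distribʳ-*; -‿involutive)
  open import Data.List.Relation.Binary.Permutation.Setoid setoid
    using (_↭_; ↭-refl; ↭-sym; ↭-trans; ↭-reflexive; ↭-prep; module PermutationReasoning)
  import Data.List.Relation.Binary.Permutation.Setoid.Properties setoid as ↭

  infix 4 _∼_
  _∼_ : Form → Form → Set (r ⊔ ℓ)
  φ ∼ ψ = ∃₂ λ m k → φ ⊥ mℍ m ≅ ψ ⊥ mℍ k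

  ∼⇒≈W : ∀ {φ ψ} → φ ∼ ψ → φ ≈W ψ
  ∼⇒≈W (m , k , φ≅ψ) = m , k , ≅⇒Isometric φ≅ψ

  ≅⇒∼ : ∀ {φ ψ} → φ ≅ ψ → φ ∼ ψ
  ≅⇒∼ {φ} {ψ} φ≅ψ = 0 , 0 ,
    ≅-trans (≅-reflexive (List.++-identityʳ φ)) (≅-trans φ≅ψ (≅-reflexive (≡.sym (List.++-identityʳ ψ))))

  ∼-reflexive : ∀ {φ ψ} → φ ≡ ψ → φ ∼ ψ
  ∼-reflexive φ≡ψ = ≅⇒∼ (≅-reflexive φ≡ψ)

  ∼-↭ : ∀ {φ ψ} → φ ↭ ψ → φ ∼ ψ
  ∼-↭ φ↭ψ = ≅⇒∼ (≅-↭ φ↭ψ)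

  ∼-pointwise : ∀ {φ ψ} → Pointwise _≈_ φ ψ → φ ∼ ψ
  ∼-pointwise φ≈ψ = ≅⇒∼ (≅-pointwise φ≈ψ)

  ∼-refl : ∀ {φ} → φ ∼ φ
  ∼-refl = ≅⇒∼ ≅-refl

  ∼-sym : ∀ {φ ψ} → φ ∼ ψ → ψ ∼ φ
  ∼-sym (m , k , φ≅ψ) = k , m , ≅-sym φ≅ψ

  mℍ-+ : ∀ a b → mℍ (a ℕ.+ b) ≡ mℍ a ++ mℍ b
  mℍ-+ zero b = ≡.refl
  mℍ-+ (suc a) b = ≡.cong (λ L → 1# ∷ - 1# ∷ L) (mℍ-+ a b)

  private
    ++-swapʳ : ∀ X Y Z → (X ++ Y) ++ Z ↭ (X ++ Z) ++ Y
    ++-swapʳ X Y Z = ↭-trans (↭.++-assoc X Y Z)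
                             (↭-trans (↭.++⁺ˡ X (↭.++-comm Y Z)) (↭-sym (↭.++-assoc X Z Y)))

    ++-mℍ-+ : ∀ φ a b → (φ ⊥ mℍ a) ⊥ mℍ b ≅ φ ⊥ mℍ (a ℕ.+ b)
    ++-mℍ-+ φ a b =
      ≅-reflexive (≡.trans (List.++-assoc φ (mℍ a) (mℍ b)) (≡.cong (φ ++_) (≡.sym (mℍ-+ a b))))

  ∼-trans : ∀ {φ ψ χ} → φ ∼ ψ → ψ ∼ χ → φ ∼ χ
  ∼-trans {φ} {ψ} {χ} (a , b , φ≅ψ) (a′ , b′ , ψ≅χ) = a ℕ.+ a′ , b′ ℕ.+ b ,
    ≅-trans (≅-sym (++-mℍ-+ φ a a′))
    (≅-trans (≅-++ʳ (mℍ a′) φ≅ψ)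
    (≅-trans (≅-↭ (++-swapʳ ψ (mℍ b) (mℍ a′)))
    (≅-trans (≅-++ʳ (mℍ b) ψ≅χ) (++-mℍ-+ χ b′ b))))

  ∼-⊥ʳ : ∀ {φ φ′} γ → φ ∼ φ′ → φ ⊥ γ ∼ φ′ ⊥ γ
  ∼-⊥ʳ {φ} {φ′} γ (a , b , φ≅φ′) = a , b ,
    ≅-trans (≅-↭ (++-swapʳ φ γ (mℍ a)))
      (≅-trans (≅-++ʳ γ φ≅φ′) (≅-↭ (++-swapʳ φ′ (mℍ b) γ)))

  ∼-⊥ˡ : ∀ γ {φ φ′} → φ ∼ φ′ → γ ⊥ φ ∼ γ ⊥ φ′
  ∼-⊥ˡ γ {φ} {φ′} (a , b , φ≅φ′) = a , b ,
    ≅-trans (≅-reflexive (List.++-assoc γ φ (mℍ a)))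
      (≅-trans (≅-++ˡ γ φ≅φ′) (≅-reflexive (≡.sym (List.++-assoc γ φ′ (mℍ b)))))

  ∼-⊥ : ∀ {φ φ′ ψ ψ′} → φ ∼ φ′ → ψ ∼ ψ′ → φ ⊥ ψ ∼ φ′ ⊥ ψ′
  ∼-⊥ {φ′ = φ′} {ψ} φ∼φ′ ψ∼ψ′ = ∼-trans (∼-⊥ʳ ψ φ∼φ′) (∼-⊥ˡ φ′ ψ∼ψ′)

  ∼-absorb : ∀ φ {η} → η ∼ [] → φ ⊥ η ∼ φ
  ∼-absorb φ η∼0 = ∼-trans (∼-⊥ˡ φ η∼0) (∼-reflexive (List.++-identityʳ φ))

  hyperbolic∼0 : ∀ {a} → IsUnit a → a ∷ - a ∷ [] ∼ []
  hyperbolic∼0 a-unit = 0 , 1 , ≅-hyperbolic two-unit a-unit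

  -- Scaling by b preserves ∼ only for units b (⟨0⟩ ⊗ ℍ is not hyperbolic), so W(F) is built on these forms.
  AllUnits : Form → Set (r ⊔ ℓ)
  AllUnits = All IsUnit

  ⊥-neg∼0 : ∀ {φ} → AllUnits φ → φ ⊥ neg φ ∼ []
  ⊥-neg∼0 {[]} [] = ∼-refl
  ⊥-neg∼0 {a ∷ φ} (a-unit ∷ φ-units) =
    ∼-trans (∼-↭ (↭-prep a (↭.↭-shift φ (neg φ))))
            (∼-⊥ (hyperbolic∼0 a-unit) (⊥-neg∼0 φ-units))

  scale-mℍ∼0 : ∀ {b} → IsUnit b → ∀ m → map (b *_) (mℍ m) ∼ []
  scale-mℍ∼0 b-unit zero = ∼-refl
  scale-mℍ∼0 {b} b-unit (suc m) =
    ∼-⊥ (∼-trans (∼-pointwise b·ℍ≈) (hyperbolic∼0 b-unit)) (scale-mℍ∼0 b-unit m)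
    where
    b·ℍ≈ : Pointwise _≈_ (b * 1# ∷ b * - 1# ∷ []) (b ∷ - b ∷ [])
    b·ℍ≈ = *-identityʳ b ∷ trans (sym (-‿distribʳ-* b 1#)) (-‿cong (*-identityʳ b)) ∷ []

  ∼-scale : ∀ {b} → IsUnit b → ∀ {φ ψ} → φ ∼ ψ → map (b *_) φ ∼ map (b *_) ψ
  ∼-scale {b} b-unit {φ} {ψ} (m , k , φ≅ψ) =
    ∼-trans (∼-sym (∼-absorb (map (b *_) φ) (scale-mℍ∼0 b-unit m)))
    (∼-trans (≅⇒∼ (≅-trans (≅-reflexive (≡.sym (List.map-++ (b *_) φ (mℍ m))))
                  (≅-trans (≅-scale b φ≅ψ) (≅-reflexive (List.map-++ (b *_) ψ (mℍ k))))))
    (∼-absorb (map (b *_) ψ) (scale-mℍ∼0 b-unit k)))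

  ∼-neg : ∀ {φ ψ} → φ ∼ ψ → neg φ ∼ neg ψ
  ∼-neg {φ} {ψ} φ∼ψ =
    ∼-trans (∼-pointwise (neg≈-1· φ)) (∼-trans (∼-scale -1-unit φ∼ψ) (∼-sym (∼-pointwise (neg≈-1· ψ))))
    where
    neg≈-1· : ∀ φ → Pointwise _≈_ (neg φ) (map (- 1# *_) φ)
    neg≈-1· [] = []
    neg≈-1· (a ∷ φ) = sym (-1*x≈-x a) ∷ neg≈-1· φ
    -1-unit : IsUnit (- 1#)
    -1-unit = - 1# , trans (-1*x≈-x (- 1#)) (-‿involutive 1#)

  ⊗-distribʳ-⊥ : ∀ φ ψ χ → (φ ⊥ ψ) ⊗ χ ≡ (φ ⊗ χ) ⊥ (ψ ⊗ χ)
  ⊗-distribʳ-⊥ φ ψ χ =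
    ≡.trans (≡.cong concat (List.map-++ scaled φ ψ)) (≡.sym (List.concat-++ (map scaled φ) (map scaled ψ)))
    where
    scaled : K → Form
    scaled a = map (a *_) χ

  private
    map-*-assoc : ∀ a b χ → Pointwise _≈_ (map ((a * b) *_) χ) (map (a *_) (map (b *_) χ))
    map-*-assoc a b [] = []
    map-*-assoc a b (x ∷ χ) = *-assoc a b x ∷ map-*-assoc a b χ

    ⊗-assoc-map : ∀ a ψ χ → Pointwise _≈_ (map (a *_) ψ ⊗ χ) (map (a *_) (ψ ⊗ χ))
    ⊗-assoc-map a [] χ = []
    ⊗-assoc-map a (b ∷ ψ) χ =
      ≡.subst (Pointwise _≈_ _) (≡.sym (List.map-++ (a *_) (map (b *_) χ) (ψ ⊗ χ)))
        (Pointwise.++⁺ (map-*-assoc a b χ) (⊗-assoc-map a ψ χ))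

  ⊗-assoc : ∀ φ ψ χ → Pointwise _≈_ ((φ ⊗ ψ) ⊗ χ) (φ ⊗ (ψ ⊗ χ))
  ⊗-assoc [] ψ χ = []
  ⊗-assoc (a ∷ φ) ψ χ =
    ≡.subst (λ L → Pointwise _≈_ L (map (a *_) (ψ ⊗ χ) ++ (φ ⊗ (ψ ⊗ χ))))
      (≡.sym (⊗-distribʳ-⊥ (map (a *_) ψ) (φ ⊗ ψ) χ))
      (Pointwise.++⁺ (⊗-assoc-map a ψ χ) (⊗-assoc φ ψ χ))

  ⊗-identityˡ : ∀ φ → Pointwise _≈_ (⟨1⟩ ⊗ φ) φ
  ⊗-identityˡ [] = []
  ⊗-identityˡ (a ∷ φ) = *-identityˡ a ∷ ⊗-identityˡ φ

  ⊗-identityʳ : ∀ φ → Pointwise _≈_ (φ ⊗ ⟨1⟩) φ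
  ⊗-identityʳ [] = []
  ⊗-identityʳ (a ∷ φ) = *-identityʳ a ∷ ⊗-identityʳ φ

  private
    concat-map-∷ : ∀ (f : K → K) (g : K → Form) ψ →
                   concat (map (λ b → f b ∷ g b) ψ) ↭ map f ψ ++ concat (map g ψ)
    concat-map-∷ f g [] = ↭-refl
    concat-map-∷ f g (b ∷ ψ) =
      ↭-prep (f b) (↭-trans (↭.++⁺ˡ (g b) (concat-map-∷ f g ψ)) (↭.shifts (g b) (map f ψ)))

    ⊗-[] : ∀ ψ → ψ ⊗ [] ≡ []
    ⊗-[] [] = ≡.refl
    ⊗-[] (b ∷ ψ) = ⊗-[] ψ

    map-*-comm : ∀ a ψ → Pointwise _≈_ (map (a *_) ψ) (map (_* a) ψ)
    map-*-comm a [] = []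
    map-*-comm a (x ∷ ψ) = *-comm a x ∷ map-*-comm a ψ

  ⊗-comm : ∀ φ ψ → φ ⊗ ψ ↭ ψ ⊗ φ
  ⊗-comm [] ψ = ↭-reflexive (≡.sym (⊗-[] ψ))
  ⊗-comm (a ∷ φ) ψ = ↭-trans (↭.++⁺ (Homogeneous.refl (map-*-comm a ψ)) (⊗-comm φ ψ))
                              (↭-sym (concat-map-∷ (_* a) (λ b → map (b *_) φ) ψ))

  ⊗-distribˡ-⊥ : ∀ φ ψ χ → φ ⊗ (ψ ⊥ χ) ↭ (φ ⊗ ψ) ⊥ (φ ⊗ χ)
  ⊗-distribˡ-⊥ [] ψ χ = ↭-refl
  ⊗-distribˡ-⊥ (a ∷ φ) ψ χ = begin
    map (a *_) (ψ ++ χ) ++ φ ⊗ (ψ ++ χ)  ≡⟨ ≡.cong (_++ φ ⊗ (ψ ++ χ)) (List.map-++ (a *_) ψ χ) ⟩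
    (aψ ++ aχ) ++ φ ⊗ (ψ ++ χ)           ↭⟨ ↭.++⁺ˡ (aψ ++ aχ) (⊗-distribˡ-⊥ φ ψ χ) ⟩
    (aψ ++ aχ) ++ (φ ⊗ ψ ++ φ ⊗ χ)        ↭⟨ ↭.++-assoc aψ aχ (φ ⊗ ψ ++ φ ⊗ χ) ⟩
    aψ ++ (aχ ++ (φ ⊗ ψ ++ φ ⊗ χ))       ↭⟨ ↭.++⁺ˡ aψ (↭.shifts aχ (φ ⊗ ψ)) ⟩
    aψ ++ (φ ⊗ ψ ++ (aχ ++ φ ⊗ χ))       ↭⟨ ↭.++-assoc aψ (φ ⊗ ψ) (aχ ++ φ ⊗ χ) ⟨
    (aψ ++ φ ⊗ ψ) ++ (aχ ++ φ ⊗ χ)       ∎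
    where
    open PermutationReasoning
    aψ aχ : Form
    aψ = map (a *_) ψ
    aχ = map (a *_) χ

  AllUnits-⊗ : ∀ {φ ψ} → AllUnits φ → AllUnits ψ → AllUnits (φ ⊗ ψ)
  AllUnits-⊗ [] ψ-units = []
  AllUnits-⊗ (a-unit ∷ φ-units) ψ-units =
    All.++⁺ (All.map⁺ (All.map (IsUnit-* a-unit) ψ-units)) (AllUnits-⊗ φ-units ψ-units)

  AllUnits-neg : ∀ {φ} → AllUnits φ → AllUnits (neg φ)
  AllUnits-neg φ-units = All.map⁺ (All.map IsUnit-neg φ-units)

  ∼-⊗ˡ : ∀ {γ} → AllUnits γ → ∀ {φ ψ} → φ ∼ ψ → γ ⊗ φ ∼ γ ⊗ ψ
  ∼-⊗ˡ [] φ∼ψ = ∼-refl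
  ∼-⊗ˡ (b-unit ∷ γ-units) φ∼ψ = ∼-⊥ (∼-scale b-unit φ∼ψ) (∼-⊗ˡ γ-units φ∼ψ)

  ∼-⊗ : ∀ {φ φ′ ψ ψ′} → AllUnits φ → AllUnits ψ′ →
        φ ∼ φ′ → ψ ∼ ψ′ → φ ⊗ ψ ∼ φ′ ⊗ ψ′
  ∼-⊗ {φ} {φ′} {ψ} {ψ′} φ-units ψ′-units φ∼φ′ ψ∼ψ′ =
    ∼-trans (∼-⊗ˡ φ-units ψ∼ψ′)
      (∼-trans (∼-↭ (⊗-comm φ ψ′)) (∼-trans (∼-⊗ˡ ψ′-units φ∼φ′) (∼-↭ (⊗-comm ψ′ φ′))))

  wittRing : CommutativeRing (r ⊔ ℓ) (r ⊔ ℓ)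
  wittRing = record
    { Carrier = Σ Form AllUnits
    ; _≈_ = λ x y → proj₁ x ∼ proj₁ y
    ; _+_ = λ x y → proj₁ x ⊥ proj₁ y , All.++⁺ (proj₂ x) (proj₂ y)
    ; _*_ = λ x y → proj₁ x ⊗ proj₁ y , AllUnits-⊗ (proj₂ x) (proj₂ y)
    ; -_ = λ x → neg (proj₁ x) , AllUnits-neg (proj₂ x)
    ; 0# = [] , []
    ; 1# = ⟨1⟩ , (1# , *-identityʳ 1#) ∷ []
    ; isCommutativeRing = record
      { isRing = record
        { +-isAbelianGroup = record
          { isGroup = record
            { isMonoid = record
              { isSemigroup = record
                { isMagma = record
                  { isEquivalence = record { refl = ∼-refl ; sym = ∼-sym ; trans = ∼-trans }
                  ; ∙-cong = ∼-⊥ }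
                ; assoc = λ x y z → ∼-reflexive (List.++-assoc (proj₁ x) (proj₁ y) (proj₁ z)) }
              ; identity = (λ x → ∼-refl) , (λ x → ∼-reflexive (List.++-identityʳ (proj₁ x))) }
            ; inverse = (λ x → ∼-trans (∼-↭ (↭.++-comm (neg (proj₁ x)) (proj₁ x))) (⊥-neg∼0 (proj₂ x)))
                      , (λ x → ⊥-neg∼0 (proj₂ x))
            ; ⁻¹-cong = ∼-neg }
          ; comm = λ x y → ∼-↭ (↭.++-comm (proj₁ x) (proj₁ y)) }
        ; *-cong = λ {x} {x′} {y} {y′} x∼x′ y∼y′ → ∼-⊗ (proj₂ x) (proj₂ y′) x∼x′ y∼y′
        ; *-assoc = λ x y z → ∼-pointwise (⊗-assoc (proj₁ x) (proj₁ y) (proj₁ z))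
        ; *-identity = (λ x → ∼-pointwise (⊗-identityˡ (proj₁ x)))
                     , (λ x → ∼-pointwise (⊗-identityʳ (proj₁ x)))
        ; distrib = (λ x y z → ∼-↭ (⊗-distribˡ-⊥ (proj₁ x) (proj₁ y) (proj₁ z)))
                  , (λ x y z → ∼-reflexive (⊗-distribʳ-⊥ (proj₁ y) (proj₁ z) (proj₁ x))) }
      ; *-comm = λ x y → ∼-↭ (⊗-comm (proj₁ x) (proj₁ y)) } }

module PfisterExpansionInWitt {r ℓ} (F : CommutativeRing r ℓ) (two-unit : DiagonalForms.TwoIsUnit F) where

  open CommutativeRing F using (_*_; 1#) renaming (Carrier to K)
  open Witt F
  open DiagonalForms F using (IsUnit; ≅-square)
  open WittRing F two-unit
  module W = CommutativeRing wittRing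
  open IntegerCoefficients wittRing using (_×ℤ_)
  open RangeSums wittRing using (sumList)
  open PfisterCalculus wittRing using (SquaresToOne; pfisterProduct; pfisterSum)
  open PolynomialExpansion wittRing using (evaluate; pfisterExpansion; evaluate≈pfisterExpansion)
  open import Algebra.Properties.Semiring.Exp W.semiring using () renaming (_^_ to _^ᵂ_)
  open import Algebra.Properties.Semiring.Mult W.semiring using () renaming (_×_ to _×ᵂ_)
  open ≡.≡-Reasoning

  singleton : Σ K IsUnit → W.Carrier
  singleton (a , a-unit) = a ∷ [] , a-unit ∷ []

  singleton-squaresToOne : ∀ a → SquaresToOne (singleton a)
  singleton-squaresToOne (a , a-unit) = ≅⇒∼ (≅-square a-unit)

  proj₁-sumList : ∀ {a} {A : Set a} (f : A → W.Carrier) xs →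
                  proj₁ (sumList (map f xs)) ≡ ⊥-sum (map (proj₁ ∘ f) xs)
  proj₁-sumList f [] = ≡.refl
  proj₁-sumList f (x ∷ xs) = ≡.cong (proj₁ (f x) ++_) (proj₁-sumList f xs)

  proj₁-× : ∀ m x → proj₁ (m ×ᵂ x) ≡ concat (replicate m (proj₁ x))
  proj₁-× zero x = ≡.refl
  proj₁-× (suc m) x = ≡.cong (proj₁ x ++_) (proj₁-× m x)

  proj₁-×ℤ : ∀ k x → proj₁ (k ×ℤ x) ≡ k · proj₁ x
  proj₁-×ℤ (+ m) x = proj₁-× m x
  proj₁-×ℤ -[1+ m ] x = proj₁-× (suc m) (W.- x)

  proj₁-^ : ∀ x n → proj₁ (x ^ᵂ n) ≡ proj₁ x ^ n
  proj₁-^ x zero = ≡.refl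
  proj₁-^ x (suc n) = ≡.cong (proj₁ x ⊗_) (proj₁-^ x n)

  proj₁-pfisterProduct : ∀ S → proj₁ (pfisterProduct (map singleton S)) ≡ pfister (map proj₁ S)
  proj₁-pfisterProduct [] = ≡.refl
  proj₁-pfisterProduct ((a , _) ∷ S) = ≡.cong ((1# ∷ a ∷ []) ⊗_) (proj₁-pfisterProduct S)

  proj₁-pfisterSum : ∀ L p →
                     proj₁ (pfisterSum (map singleton L) p) ≡ ⊥-sum (map pfister (choose (map proj₁ L) p))
  proj₁-pfisterSum L p = begin
    proj₁ (sumList (map pfisterProduct (choose (map singleton L) p)))
      ≡⟨ proj₁-sumList pfisterProduct (choose (map singleton L) p) ⟩
    ⊥-sum (map (proj₁ ∘ pfisterProduct) (choose (map singleton L) p))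
      ≡⟨ ≡.cong (⊥-sum ∘ map (proj₁ ∘ pfisterProduct)) (choose-map singleton L p) ⟩
    ⊥-sum (map (proj₁ ∘ pfisterProduct) (map (map singleton) (choose L p)))
      ≡⟨ ≡.cong ⊥-sum (List.map-∘ (choose L p)) ⟨
    ⊥-sum (map (proj₁ ∘ pfisterProduct ∘ map singleton) (choose L p))
      ≡⟨ ≡.cong ⊥-sum (List.map-cong proj₁-pfisterProduct (choose L p)) ⟩
    ⊥-sum (map (pfister ∘ map proj₁) (choose L p))
      ≡⟨ ≡.cong ⊥-sum (List.map-∘ (choose L p)) ⟩
    ⊥-sum (map pfister (map (map proj₁) (choose L p)))
      ≡⟨ ≡.cong (⊥-sum ∘ map pfister) (choose-map proj₁ L p) ⟨
    ⊥-sum (map pfister (choose (map proj₁ L) p)) ∎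

  singletons-squaresToOne : ∀ L → All SquaresToOne (map singleton L)
  singletons-squaresToOne [] = []
  singletons-squaresToOne (a ∷ L) = singleton-squaresToOne a ∷ singletons-squaresToOne L

  proj₁-sum-singletons : ∀ L → proj₁ (sumList (map singleton L)) ≡ map proj₁ L
  proj₁-sum-singletons [] = ≡.refl
  proj₁-sum-singletons (a ∷ L) = ≡.cong (proj₁ a ∷_) (proj₁-sum-singletons L)

  proj₁-evaluate : ∀ cs x → proj₁ (evaluate cs x) ≡ evalPoly cs (proj₁ x)
  proj₁-evaluate cs x =
    ≡.trans (proj₁-sumList term (upTo (length cs)))
            (≡.cong ⊥-sum (List.map-cong proj₁-term (upTo (length cs))))
    where
    term : ℕ → W.Carrier
    term i = coeff cs (suc i) ×ℤ x ^ᵂ suc i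
    proj₁-term : ∀ i → proj₁ (term i) ≡ coeff cs (suc i) · (proj₁ x ^ suc i)
    proj₁-term i = ≡.trans (proj₁-×ℤ (coeff cs (suc i)) (x ^ᵂ suc i))
                           (≡.cong (coeff cs (suc i) ·_) (proj₁-^ x (suc i)))

  expansionForm : List ℤ → Form → Form
  expansionForm cs as = ⊥-sum (map (λ p → bigCoeff (length as) cs p · ⊥-sum (map pfister (choose as p)))
                                   (upTo (suc (length as))))

  proj₁-pfisterExpansion : ∀ cs L →
                           proj₁ (pfisterExpansion cs (map singleton L)) ≡ expansionForm cs (map proj₁ L)
  proj₁-pfisterExpansion cs L = begin
    proj₁ (pfisterExpansion cs gs)
      ≡⟨ proj₁-sumList term (upTo (suc (length gs))) ⟩
    ⊥-sum (map (proj₁ ∘ term) (upTo (suc (length gs))))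
      ≡⟨ ≡.cong ⊥-sum (List.map-cong proj₁-term (upTo (suc (length gs)))) ⟩
    expansionWith (length gs)
      ≡⟨ ≡.cong expansionWith (≡.trans (List.length-map singleton L) (≡.sym (List.length-map proj₁ L))) ⟩
    expansionForm cs (map proj₁ L) ∎
    where
    gs : List W.Carrier
    gs = map singleton L
    term : ℕ → W.Carrier
    term p = bigCoeff (length gs) cs p ×ℤ pfisterSum gs p
    pfisters : ℕ → Form
    pfisters p = ⊥-sum (map pfister (choose (map proj₁ L) p))
    expansionWith : ℕ → Form
    expansionWith n = ⊥-sum (map (λ p → bigCoeff n cs p · pfisters p) (upTo (suc n)))
    proj₁-term : ∀ p → proj₁ (term p) ≡ bigCoeff (length gs) cs p · pfisters p
    proj₁-term p = ≡.trans (proj₁-×ℤ (bigCoeff (length gs) cs p) (pfisterSum gs p))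
                           (≡.cong (bigCoeff (length gs) cs p ·_) (proj₁-pfisterSum L p))

  evalPoly∼expansionForm : ∀ cs (L : List (Σ K IsUnit)) →
                           evalPoly cs (map proj₁ L) ∼ expansionForm cs (map proj₁ L)
  evalPoly∼expansionForm cs L =
    ≡.subst₂ _∼_ (≡.trans (proj₁-evaluate cs (sumList gs)) (≡.cong (evalPoly cs) (proj₁-sum-singletons L)))
                 (proj₁-pfisterExpansion cs L)
                 (evaluate≈pfisterExpansion gs (singletons-squaresToOne L) cs (W.refl {sumList gs}))
    where
    gs : List W.Carrier
    gs = map singleton L

mainTheorem3 : ∀ {c ℓ} (F : CommutativeRing c ℓ) →
    let open Witt F in
    IsField → CharNot2 →
    (cs : List ℤ) (as : List (CommutativeRing.Carrier F)) →
    Nonsingular as → length as ≥ 1 →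
    evalPoly cs as ≈W
      ⊥-sum (map (λ p → bigCoeff (length as) cs p · ⊥-sum (map pfister (choose as p)))
                 (upTo (suc (length as))))
-- The identity also holds for n = 0.
mainTheorem3 F isField char≠2 cs as nonsingular _ =
  ≡.subst (λ bs → evalPoly cs bs ≈W expansionForm cs bs) (map-proj₁-toList units)
    (∼⇒≈W (evalPoly∼expansionForm cs (All.toList units)))
  where
  open CommutativeRing F using (_+_; 1#)
  open Witt F
  open IsField isField
  two-unit : DiagonalForms.TwoIsUnit F
  two-unit = inverse (1# + 1#) char≠2
  units : All (DiagonalForms.IsUnit F) as
  units = All.map (inverse _) nonsingular
  open WittRing F two-unit using (∼⇒≈W)
  open PfisterExpansionInWitt F two-unit using (expansionForm; evalPoly∼expansionForm)
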